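{- Let $Q(x)=\sqrt{1-2\sqrt{x}-3x}$, $R(x)=\sqrt{1+2\sqrt{x}-3x}$ and $P(x)=Q(x)R(x)=\sqrt{1-10x+9x^2}$. Then $$\sum_{n\ge0}\sum_{m\ge0}A^{Q}_{R}(n,m)x^ny^m=\frac{R(x)+Q(x)+2}{\big(1+Q(x)-\sqrt{x}(1+2y)\big)\big(1+R(x)+\sqrt{x}(1+2y)\big)},$$ $$\sum_{n\ge0}\sum_{m\ge0}A^{Q}(n,m)x^ny^m=\frac{R(x)-Q(x)+2\sqrt{x}(1+2y)}{\sqrt{x}\big(1+Q(x)-\sqrt{x}(1+2y)\big)\big(1+R(x)+\sqrt{x}(1+2y)\big)},$$ $$\sum_{n\ge0}A^{Q}_{R}(n,0)x^n=\frac{1}{2x}\left(1-\sqrt{\frac{1-3x+P(x)}{2}}\right),\qquad \sum_{n\ge0}A^{Q}(n,0)x^n=\frac{1}{2x}\left(\sqrt{\frac{1-3x-P(x)}{2x}}-1\right).$$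
   Context: A lattice path is a finite sequence of steps (vectors in $\mathbb{Z}^2$) starting at $(0,0)$; its vertices are the partial sums, and it terminates at the last vertex (the empty path terminates at $(0,0)$). Let $S_{M}=\{(1,0),(1,1),(1,-1)\}$ and $S_{MW}=S_M\cup\{(0,1),(0,-1)\}$; $(0,\pm1)$ are vertical steps. A vertically constrained $S_{MW}$ path is a lattice path with steps in $S_{MW}$ with no two consecutive vertical steps. $A^{Q}(n,m)$ is the number of vertically constrained $S_{MW}$ paths from $(0,0)$ to $(n,m)$ all of whose vertices have $y\ge0$, and $A^{Q}_{R}(n,m)$ is the number of those whose first step (if any) lies in $S_M$. -}

module Defs where

open import Data.Nat using (ℕ; zero; suc; _∸_)
open import Data.Integer using (ℤ; +_; -_; _+_; _*_; _-_; _≤_; 0ℤ; 1ℤ)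
open import Data.Bool using (Bool; true; false; _∧_)
open import Data.List using (List; []; _∷_; length)
open import Data.List.Relation.Unary.All using (All)
open import Data.List.Relation.Unary.Unique.Propositional using (Unique)
open import Data.List.Membership.Propositional using (_∈_)
open import Data.Product using (Σ; _×_)
open import Data.Unit using (⊤)
open import Relation.Binary.PropositionalEquality using (_≡_)

data Step : Set where
  E U D : Step
  N S   : Step

dx : Step → ℤ
dx E = + 1
dx U = + 1
dx D = + 1
dx N = 0ℤ
dx S = 0ℤ

dy : Step → ℤ
dy E = 0ℤ
dy U = + 1
dy D = - (+ 1)
dy N = + 1
dy S = - (+ 1)

vertical : Step → Bool
vertical N = true
vertical S = true
vertical _ = false

Path : Set
Path = List Step

endX : Path → ℤ
endX []       = 0ℤ
endX (s ∷ ss) = dx s + endX ss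

endY : Path → ℤ
endY []       = 0ℤ
endY (s ∷ ss) = dy s + endY ss

data VertConstrained : Path → Set where
  vc-nil  : VertConstrained []
  vc-one  : ∀ s → VertConstrained (s ∷ [])
  vc-cons : ∀ s t ss → vertical s ∧ vertical t ≡ false →
            VertConstrained (t ∷ ss) → VertConstrained (s ∷ t ∷ ss)

NonnegFrom : ℤ → Path → Set
NonnegFrom h []       = ⊤
NonnegFrom h (s ∷ ss) = (0ℤ ≤ h + dy s) × NonnegFrom (h + dy s) ss

Nonneg : Path → Set
Nonneg p = NonnegFrom 0ℤ p

FirstInSM : Path → Set
FirstInSM []      = ⊤
FirstInSM (s ∷ _) = vertical s ≡ false

IsAQPath : ℕ → ℕ → Path → Set
IsAQPath n m p = VertConstrained p × Nonneg p × endX p ≡ + n × endY p ≡ + m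

IsAQRPath : ℕ → ℕ → Path → Set
IsAQRPath n m p = IsAQPath n m p × FirstInSM p

HasSize : (Path → Set) → ℕ → Set
HasSize P c = Σ (List Path) λ xs →
  Unique xs × All P xs × (∀ p → P p → p ∈ xs) × length xs ≡ c

-- Formal power series with integer coefficients.
-- Series1 : f k = coefficient of z^k (z is x or t = √x depending on use)
-- Series2 : F i j = coefficient of t^i y^j

Series1 : Set
Series1 = ℕ → ℤ

Series2 : Set
Series2 = ℕ → ℕ → ℤ

sumTo : (ℕ → ℤ) → ℕ → ℤ
sumTo f zero    = f zero
sumTo f (suc n) = sumTo f n + f (suc n)

_⊕_ : Series1 → Series1 → Series1
(f ⊕ g) k = f k + g k

_⊖_ : Series1 → Series1 → Series1
(f ⊖ g) k = f k - g k

_⊛_ : Series1 → Series1 → Series1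
(f ⊛ g) k = sumTo (λ a → f a * g (k ∸ a)) k

infixl 6 _⊕_ _⊖_
infixl 7 _⊛_

poly : List ℤ → Series1
poly []       k       = 0ℤ
poly (c ∷ cs) zero    = c
poly (c ∷ cs) (suc k) = poly cs k

_≈₁_ : Series1 → Series1 → Set
f ≈₁ g = ∀ k → f k ≡ g k

_⊕₂_ : Series2 → Series2 → Series2
(F ⊕₂ G) i j = F i j + G i j

_⊖₂_ : Series2 → Series2 → Series2
(F ⊖₂ G) i j = F i j - G i j

_⊛₂_ : Series2 → Series2 → Series2
(F ⊛₂ G) i j = sumTo (λ a → sumTo (λ b → F a b * G (i ∸ a) (j ∸ b)) j) i

infixl 6 _⊕₂_ _⊖₂_
infixl 7 _⊛₂_

_≈₂_ : Series2 → Series2 → Set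
F ≈₂ G = ∀ i j → F i j ≡ G i j

lift : Series1 → Series2
lift f i zero    = f i
lift f i (suc j) = 0ℤ

-- the series t (1 + 2y) = √x (1 + 2y)
tY : Series2
tY (suc zero) zero       = + 1
tY (suc zero) (suc zero) = + 2
tY _          _          = 0ℤ

tS : Series2
tS (suc zero) zero = + 1
tS _          _    = 0ℤ

-- substitution x = t² : coefficient of t^i y^j in F(t², y)
isEven : ℕ → Bool
isEven zero          = true
isEven (suc zero)    = false
isEven (suc (suc n)) = isEven n

half : ℕ → ℕ
half zero          = zero
half (suc zero)    = zero
half (suc (suc n)) = suc (half n)

substSq : (ℕ → ℕ → ℕ) → Series2
substSq a i j with isEven i
... | true  = + (a (half i) j)
... | false = 0ℤ

diag0 : (ℕ → ℕ → ℕ) → Series1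
diag0 a n = + (a n 0)

infix 4 _≈₁_ _≈₂_

-- Between two horizontal steps a vertically constrained path makes at most one vertical step, so
-- reading every horizontal step, and the vertical step after it (if any), as a Motzkin step up,
-- level or down identifies the paths counted by A^Q_R(n,m) and A^Q(n,m) with the Motzkin paths of
-- length 2n and 2n + 1 from height 0 to height m. Writing t = √x and G(t,y) for the generating
-- function of Motzkin paths by length and final height, the series in the first two identities are
-- therefore the even and odd parts (G(t,y) ± G(−t,y))/2. The kernel method gives
-- G · (1 + Q − t(1 + 2y)) = 2, where Q = 1 − t − 2tz and z is the power series root of
-- z = t(1 + z + z²); replacing t by −t turns Q into R, and the first two identities follow. At y = 0
-- this says M(t)(1 + Q − t) = 2 for the Motzkin series M = G(t,0), and the last two identities
-- follow by comparing squares after the substitution x = t², since P(t²) = Q(t)R(t) and a square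
-- root with constant term 1 is unique.

module Submission where

open import Algebra.Bundles using (CommutativeRing)
open import Data.Nat as ℕ using (ℕ; zero; suc; _∸_; _≤_; _<_; z≤n; s≤s)
import Data.Nat.Properties as ℕP
open import Data.Product using (Σ; _×_; _,_; proj₁; proj₂)
import Relation.Binary.PropositionalEquality as ≡

-- Formal power series over a commutative ring

module PowerSeries {c ℓ} (CR : CommutativeRing c ℓ) where
  open CommutativeRing CR hiding (zero)
  open import Algebra.Properties.Ring ring using (-‿distribˡ-*; -‿distribʳ-*)
  open import Algebra.Properties.AbelianGroup +-abelianGroup using (⁻¹-∙-comm; ε⁻¹≈ε)
  open import Algebra.Properties.CommutativeSemigroup +-commutativeSemigroup using (interchange)
  open import Relation.Binary.Reasoning.Setoid setoid

  Series : Set c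
  Series = ℕ → Carrier

  infix 4 _≋_
  _≋_ : Series → Series → Set ℓ
  f ≋ g = ∀ k → f k ≈ g k

  sum≤ : (ℕ → Carrier) → ℕ → Carrier
  sum≤ f zero    = f zero
  sum≤ f (suc n) = sum≤ f n + f (suc n)

  infixl 6 _⊞_
  infixl 7 _⊠_
  infix  8 ⊟_

  _⊞_ : Series → Series → Series
  (f ⊞ g) k = f k + g k

  ⊟_ : Series → Series
  (⊟ f) k = - f k

  _⊠_ : Series → Series → Series
  (f ⊠ g) k = sum≤ (λ a → f a * g (k ∸ a)) k

  const : Carrier → Series
  const x zero    = x
  const x (suc _) = 0#

  X : Series
  X (suc zero) = 1#
  X _          = 0#

  tail : Series → Series
  tail f k = f (suc k)

  scale : Carrier → Series → Series
  scale x f k = x * f k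

  sum≤-cong : ∀ {f g} n → (∀ a → a ≤ n → f a ≈ g a) → sum≤ f n ≈ sum≤ g n
  sum≤-cong zero    p = p zero z≤n
  sum≤-cong (suc n) p = +-cong (sum≤-cong n (λ a a≤n → p a (ℕP.m≤n⇒m≤1+n a≤n))) (p (suc n) ℕP.≤-refl)

  sum≤-cong′ : ∀ {f g} n → (∀ a → f a ≈ g a) → sum≤ f n ≈ sum≤ g n
  sum≤-cong′ n p = sum≤-cong n (λ a _ → p a)

  sum≤-zero : ∀ f n → (∀ a → a ≤ n → f a ≈ 0#) → sum≤ f n ≈ 0#
  sum≤-zero f n p = trans (sum≤-cong n p) (lemma n)
    where
    lemma : ∀ n → sum≤ (λ _ → 0#) n ≈ 0#
    lemma zero    = refl
    lemma (suc n) = trans (+-identityʳ _) (lemma n)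

  sum≤-+ : ∀ f g n → sum≤ (λ a → f a + g a) n ≈ sum≤ f n + sum≤ g n
  sum≤-+ f g zero    = refl
  sum≤-+ f g (suc n) = trans (+-congʳ (sum≤-+ f g n)) (interchange _ _ _ _)

  *-sum≤ : ∀ x f n → x * sum≤ f n ≈ sum≤ (λ a → x * f a) n
  *-sum≤ x f zero    = refl
  *-sum≤ x f (suc n) = trans (distribˡ x _ _) (+-congʳ (*-sum≤ x f n))

  sum≤-suc : ∀ f n → sum≤ f (suc n) ≈ f 0 + sum≤ (λ a → f (suc a)) n
  sum≤-suc f zero    = refl
  sum≤-suc f (suc n) = trans (+-congʳ (sum≤-suc f n)) (+-assoc _ _ _)

  sum≤-reverse : ∀ f n → sum≤ f n ≈ sum≤ (λ a → f (n ∸ a)) n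
  sum≤-reverse f zero    = refl
  sum≤-reverse f (suc n) = begin
    sum≤ f n + f (suc n)                        ≈⟨ +-comm _ _ ⟩
    f (suc n) + sum≤ f n                        ≈⟨ +-congˡ (sum≤-reverse f n) ⟩
    f (suc n) + sum≤ (λ a → f (n ∸ a)) n        ≈⟨ sum≤-suc _ n ⟨
    sum≤ (λ a → f (suc n ∸ a)) (suc n)          ∎

  ⊠-suc : ∀ f g k → (f ⊠ g) (suc k) ≈ f 0 * g (suc k) + (tail f ⊠ g) k
  ⊠-suc f g k = sum≤-suc (λ a → f a * g (suc k ∸ a)) k

  ⊠-cong : ∀ {f f′ g g′} → f ≋ f′ → g ≋ g′ → f ⊠ g ≋ f′ ⊠ g′
  ⊠-cong p q k = sum≤-cong′ k (λ a → *-cong (p a) (q (k ∸ a)))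

  ⊠-comm : ∀ f g → f ⊠ g ≋ g ⊠ f
  ⊠-comm f g k = trans (sum≤-reverse _ k) (sum≤-cong k (λ a a≤k →
    trans (*-comm _ _) (*-congʳ (reflexive (≡.cong g (ℕP.m∸[m∸n]≡n a≤k))))))

  ⊠-distribˡ : ∀ f g h → f ⊠ (g ⊞ h) ≋ f ⊠ g ⊞ f ⊠ h
  ⊠-distribˡ f g h k = trans (sum≤-cong′ k (λ a → distribˡ (f a) _ _)) (sum≤-+ _ _ k)

  ⊠-distribʳ : ∀ f g h → (g ⊞ h) ⊠ f ≋ g ⊠ f ⊞ h ⊠ f
  ⊠-distribʳ f g h k = trans (sum≤-cong′ k (λ a → distribʳ (f (k ∸ a)) _ _)) (sum≤-+ _ _ k)

  scale-⊠ : ∀ x f g → scale x f ⊠ g ≋ scale x (f ⊠ g)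
  scale-⊠ x f g k = trans (sum≤-cong′ k (λ a → *-assoc _ _ _)) (sym (*-sum≤ x _ k))

  ⊠-assoc : ∀ f g h → (f ⊠ g) ⊠ h ≋ f ⊠ (g ⊠ h)
  ⊠-assoc f g h zero    = *-assoc (f 0) (g 0) (h 0)
  ⊠-assoc f g h (suc k) = begin
    ((f ⊠ g) ⊠ h) (suc k)
      ≈⟨ ⊠-suc (f ⊠ g) h k ⟩
    (f 0 * g 0) * h (suc k) + (tail (f ⊠ g) ⊠ h) k
      ≈⟨ +-congˡ (⊠-cong {g = h} (⊠-suc f g) (λ _ → refl) k) ⟩
    (f 0 * g 0) * h (suc k) + ((scale (f 0) (tail g) ⊞ tail f ⊠ g) ⊠ h) k
      ≈⟨ +-congˡ (⊠-distribʳ h _ _ k) ⟩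
    (f 0 * g 0) * h (suc k) + ((scale (f 0) (tail g) ⊠ h) k + ((tail f ⊠ g) ⊠ h) k)
      ≈⟨ +-congˡ (+-cong (scale-⊠ (f 0) (tail g) h k) (⊠-assoc (tail f) g h k)) ⟩
    (f 0 * g 0) * h (suc k) + (f 0 * (tail g ⊠ h) k + (tail f ⊠ (g ⊠ h)) k)
      ≈⟨ +-assoc _ _ _ ⟨
    ((f 0 * g 0) * h (suc k) + f 0 * (tail g ⊠ h) k) + (tail f ⊠ (g ⊠ h)) k
      ≈⟨ +-congʳ (trans (+-congʳ (*-assoc _ _ _)) (sym (distribˡ _ _ _))) ⟩
    f 0 * (g 0 * h (suc k) + (tail g ⊠ h) k) + (tail f ⊠ (g ⊠ h)) k
      ≈⟨ +-congʳ (*-congˡ (⊠-suc g h k)) ⟨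
    f 0 * (g ⊠ h) (suc k) + (tail f ⊠ (g ⊠ h)) k
      ≈⟨ ⊠-suc f (g ⊠ h) k ⟨
    (f ⊠ (g ⊠ h)) (suc k) ∎

  ⊠-zeroˡ : ∀ f g → (∀ k → f k ≈ 0#) → ∀ k → (f ⊠ g) k ≈ 0#
  ⊠-zeroˡ f g f≈0 k = sum≤-zero _ k (λ a _ → trans (*-congʳ (f≈0 a)) (zeroˡ _))

  const-⊠ : ∀ x g → const x ⊠ g ≋ scale x g
  const-⊠ x g zero    = refl
  const-⊠ x g (suc k) = begin
    (const x ⊠ g) (suc k)            ≈⟨ ⊠-suc (const x) g k ⟩
    x * g (suc k) + (tail (const x) ⊠ g) k
      ≈⟨ +-congˡ (⊠-zeroˡ (tail (const x)) g (λ _ → refl) k) ⟩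
    x * g (suc k) + 0#               ≈⟨ +-identityʳ _ ⟩
    x * g (suc k)                    ∎

  X-⊠-zero : ∀ g → (X ⊠ g) 0 ≈ 0#
  X-⊠-zero g = zeroˡ _

  X-⊠-suc : ∀ g k → (X ⊠ g) (suc k) ≈ g k
  X-⊠-suc g k = begin
    (X ⊠ g) (suc k)                  ≈⟨ ⊠-suc X g k ⟩
    0# * g (suc k) + (tail X ⊠ g) k  ≈⟨ +-cong (zeroˡ _) (⊠-cong {g = g} tail-X (λ _ → refl) k) ⟩
    0# + (const 1# ⊠ g) k            ≈⟨ +-identityˡ _ ⟩
    (const 1# ⊠ g) k                 ≈⟨ const-⊠ 1# g k ⟩
    1# * g k                         ≈⟨ *-identityˡ _ ⟩
    g k                              ∎
    where
    tail-X : tail X ≋ const 1#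
    tail-X zero    = refl
    tail-X (suc k) = refl

  X-⊠-tail : ∀ f → X ⊠ tail f ≋ f ⊞ ⊟ const (f 0)
  X-⊠-tail f zero    = trans (X-⊠-zero (tail f)) (sym (-‿inverseʳ (f 0)))
  X-⊠-tail f (suc k) = trans (X-⊠-suc (tail f) k) (sym (trans (+-congˡ ε⁻¹≈ε) (+-identityʳ _)))

  powerSeriesRing : CommutativeRing c ℓ
  powerSeriesRing = record
    { Carrier = Series ; _≈_ = _≋_ ; _+_ = _⊞_ ; _*_ = _⊠_ ; -_ = ⊟_ ; 0# = const 0# ; 1# = const 1#
    ; isCommutativeRing = record
      { isRing = record
        { +-isAbelianGroup = record
          { isGroup = record
            { isMonoid = record
              { isSemigroup = record
                { isMagma = record
                  { isEquivalence = record { refl = λ _ → refl ; sym = λ p k → sym (p k) ; trans = λ p q k → trans (p k) (q k) }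
                  ; ∙-cong = λ p q k → +-cong (p k) (q k) }
                ; assoc = λ _ _ _ _ → +-assoc _ _ _ }
              ; identity = (λ f → λ { zero → +-identityˡ _ ; (suc k) → +-identityˡ _ })
                         , (λ f → λ { zero → +-identityʳ _ ; (suc k) → +-identityʳ _ }) }
            ; inverse = (λ f → λ { zero → -‿inverseˡ _ ; (suc k) → -‿inverseˡ _ })
                      , (λ f → λ { zero → -‿inverseʳ _ ; (suc k) → -‿inverseʳ _ })
            ; ⁻¹-cong = λ p k → -‿cong (p k) }
          ; comm = λ _ _ _ → +-comm _ _ }
        ; *-cong = ⊠-cong
        ; *-assoc = ⊠-assoc
        ; *-identity = one-⊠ , (λ f k → trans (⊠-comm f (const 1#) k) (one-⊠ f k))
        ; distrib = ⊠-distribˡ , ⊠-distribʳ }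
      ; *-comm = ⊠-comm } }
    where
    one-⊠ : ∀ f → const 1# ⊠ f ≋ f
    one-⊠ f k = trans (const-⊠ 1# f k) (*-identityˡ _)

  const-cong : ∀ {x y} → x ≈ y → const x ≋ const y
  const-cong p zero    = p
  const-cong p (suc k) = refl

  const-+ : ∀ x y → const (x + y) ≋ const x ⊞ const y
  const-+ x y zero    = refl
  const-+ x y (suc k) = sym (+-identityˡ 0#)

  const-* : ∀ x y → const (x * y) ≋ const x ⊠ const y
  const-* x y k = sym (trans (const-⊠ x (const y) k) (lemma k))
    where
    lemma : ∀ k → x * const y k ≈ const (x * y) k
    lemma zero    = refl
    lemma (suc k) = zeroʳ x

  const-neg : ∀ x → const (- x) ≋ ⊟ const x
  const-neg x zero    = refl
  const-neg x (suc k) = sym ε⁻¹≈ε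

  neg^ : ℕ → Carrier → Carrier
  neg^ zero    x = x
  neg^ (suc k) x = - neg^ k x

  negateX : Series → Series
  negateX f k = neg^ k (f k)

  neg^-cong : ∀ k {x y} → x ≈ y → neg^ k x ≈ neg^ k y
  neg^-cong zero    p = p
  neg^-cong (suc k) p = -‿cong (neg^-cong k p)

  neg^-0# : ∀ k → neg^ k 0# ≈ 0#
  neg^-0# zero    = refl
  neg^-0# (suc k) = trans (-‿cong (neg^-0# k)) ε⁻¹≈ε

  neg^-+ : ∀ k x y → neg^ k (x + y) ≈ neg^ k x + neg^ k y
  neg^-+ zero    x y = refl
  neg^-+ (suc k) x y = trans (-‿cong (neg^-+ k x y)) (sym (⁻¹-∙-comm _ _))

  neg^-neg : ∀ k x → neg^ k (- x) ≈ - neg^ k x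
  neg^-neg zero    x = refl
  neg^-neg (suc k) x = -‿cong (neg^-neg k x)

  neg^-* : ∀ a b x y → neg^ a x * neg^ b y ≈ neg^ (a ℕ.+ b) (x * y)
  neg^-* zero    zero    x y = refl
  neg^-* zero    (suc b) x y = trans (sym (-‿distribʳ-* _ _)) (-‿cong (neg^-* zero b x y))
  neg^-* (suc a) b       x y = trans (sym (-‿distribˡ-* _ _)) (-‿cong (neg^-* a b x y))

  neg^-sum≤ : ∀ k f n → neg^ k (sum≤ f n) ≈ sum≤ (λ a → neg^ k (f a)) n
  neg^-sum≤ k f zero    = refl
  neg^-sum≤ k f (suc n) = trans (neg^-+ k _ _) (+-congʳ (neg^-sum≤ k f n))

  negateX-cong : ∀ {f g} → f ≋ g → negateX f ≋ negateX g
  negateX-cong p k = neg^-cong k (p k)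

  negateX-⊞ : ∀ f g → negateX (f ⊞ g) ≋ negateX f ⊞ negateX g
  negateX-⊞ f g k = neg^-+ k _ _

  negateX-⊟ : ∀ f → negateX (⊟ f) ≋ ⊟ negateX f
  negateX-⊟ f k = neg^-neg k (f k)

  negateX-⊠ : ∀ f g → negateX (f ⊠ g) ≋ negateX f ⊠ negateX g
  negateX-⊠ f g k = trans (neg^-sum≤ k _ k) (sum≤-cong k (λ a a≤k → sym (trans
    (neg^-* a (k ∸ a) (f a) (g (k ∸ a)))
    (reflexive (≡.cong (λ m → neg^ m (f a * g (k ∸ a))) (ℕP.m+[n∸m]≡n a≤k))))))

import Algebra.Solver.Ring
open import Algebra.Solver.Ring.AlmostCommutativeRing
  using (_-Raw-AlmostCommutative⟶_; fromCommutativeRing; Induced-equivalence)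
open import Data.Bool using (true; false; _∧_)
import Data.Bool.Properties as BoolP
open import Data.Empty using (⊥)
open import Data.Integer as ℤ using (ℤ; +_; -_; 0ℤ; 1ℤ)
import Data.Integer.Properties as ℤP
open import Data.Integer.Tactic.RingSolver using (solve-∀)
open import Data.List using (List; []; _∷_; _++_; map; length)
import Data.List.Properties as ListP
open import Data.List.Membership.Propositional using (_∈_)
open import Data.List.Membership.Propositional.Properties using (∈-map⁺; ∈-++⁺ˡ; ∈-++⁺ʳ)
open import Data.List.Membership.Propositional.Properties.WithK using (unique∧set⇒bag)
open import Data.List.Relation.Binary.BagAndSetEquality using (∼bag⇒↭)
open import Data.List.Relation.Binary.Disjoint.Propositional using (Disjoint)
open import Data.List.Relation.Binary.Permutation.Propositional.Properties using (↭-length)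
open import Data.List.Relation.Unary.All as All using (All)
import Data.List.Relation.Unary.All.Properties as AllP
open import Data.List.Relation.Unary.AllPairs as AllPairs using ()
open import Data.List.Relation.Unary.Any using (here)
open import Data.List.Relation.Unary.Unique.Propositional using (Unique)
import Data.List.Relation.Unary.Unique.Propositional.Properties as UniqueP
open import Data.Maybe using (Maybe; just; nothing)
open import Data.Maybe.Properties using (just-injective)
open import Data.Nat.Induction using (<-rec)
import Data.Nat.Tactic.RingSolver as NatSolver
open import Data.Sum using (inj₁; inj₂)
open import Data.Unit using (tt)
open import Function.Bundles using (mk⇔)
import Relation.Binary.Reasoning.Setoid
open import Relation.Binary.PropositionalEquality using (_≡_; _≢_; refl)
open import Relation.Nullary using (¬_; yes; no; contradiction)

open import Defs

-- Fixed points of contractive maps on sequences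

AgreeBelow : ∀ {a} {A : Set a} → ℕ → (ℕ → A) → (ℕ → A) → Set a
AgreeBelow n f g = ∀ k → k < n → f k ≡ g k

module FixedPoint {a} {A : Set a} (Φ : (ℕ → A) → ℕ → A)
  (contractive : ∀ n f g → AgreeBelow n f g → AgreeBelow (suc n) (Φ f) (Φ g))
  (seed : ℕ → A) where

  approximant : ℕ → ℕ → A
  approximant zero    = seed
  approximant (suc n) = Φ (approximant n)

  fix : ℕ → A
  fix k = approximant (suc k) k

  private
    approximant-agree : ∀ n → AgreeBelow n (approximant n) (approximant (suc n))
    approximant-agree zero    k ()
    approximant-agree (suc n) = contractive n _ _ (approximant-agree n)

    approximant-stable : ∀ d k → approximant (suc k ℕ.+ d) k ≡ fix k
    approximant-stable zero    k = ≡.cong (λ m → approximant m k) (ℕP.+-identityʳ (suc k))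
    approximant-stable (suc d) k = ≡.trans (≡.cong (λ m → approximant m k) (ℕP.+-suc (suc k) d))
      (≡.trans (≡.sym (approximant-agree (suc k ℕ.+ d) k (s≤s (ℕP.m≤m+n k d)))) (approximant-stable d k))

  fix-unfold : ∀ k → fix k ≡ Φ fix k
  fix-unfold k = contractive k (approximant k) fix agree k ℕP.≤-refl
    where
    agree : AgreeBelow k (approximant k) fix
    agree j j<k = ≡.trans (≡.cong (λ m → approximant m j) (≡.sym (ℕP.m+[n∸m]≡n j<k)))
                          (approximant-stable (k ∸ suc j) j)

-- Integer power series in t, and in t and y

module Univariate = PowerSeries ℤP.+-*-commutativeRing
module Bivariate  = PowerSeries Univariate.powerSeriesRing

open Univariate
  using (Series; _≋_; _⊞_; ⊟_; _⊠_; const; X; tail; scale; sum≤; negateX; neg^;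
         X-⊠-zero; X-⊠-suc; ⊠-comm; ⊠-cong; negateX-⊠; negateX-cong)
open Bivariate using ()
  renaming (Series to Series₂; _≋_ to _≋₂_; _⊞_ to _⊞₂_; ⊟_ to ⊟₂_; _⊠_ to _⊠₂_; const to const₂; X to T)

sumTo≡sum≤ : ∀ h n → sumTo h n ≡ sum≤ h n
sumTo≡sum≤ h zero    = refl
sumTo≡sum≤ h (suc n) = ≡.cong (ℤ._+ h (suc n)) (sumTo≡sum≤ h n)

⊛≗⊠ : ∀ f g → f ⊛ g ≋ f ⊠ g
⊛≗⊠ f g k = sumTo≡sum≤ _ k

sumTo-cong : ∀ {f g : ℕ → ℤ} n → (∀ a → f a ≡ g a) → sumTo f n ≡ sumTo g n
sumTo-cong zero    p = p zero
sumTo-cong (suc n) p = ≡.cong₂ ℤ._+_ (sumTo-cong n p) (p (suc n))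

⊛₂≗⊠₂ : ∀ F G → F ⊛₂ G ≋₂ F ⊠₂ G
⊛₂≗⊠₂ F G i j = ≡.trans (sumTo-cong i (λ a → sumTo≡sum≤ _ j)) (≡.sym (sum≤-at _ i))
  where
  sum≤-at : ∀ (h : ℕ → Series) n → Bivariate.sum≤ h n j ≡ sumTo (λ a → h a j) n
  sum≤-at h zero    = refl
  sum≤-at h (suc n) = ≡.cong (ℤ._+ h (suc n) j) (sum≤-at h n)

constHom₁ : ℤ.+-*-rawRing -Raw-AlmostCommutative⟶ fromCommutativeRing Univariate.powerSeriesRing
constHom₁ = record
  { ⟦_⟧ = const ; +-homo = Univariate.const-+ ; *-homo = Univariate.const-* ; -‿homo = Univariate.const-neg
  ; 0-homo = λ _ → refl ; 1-homo = λ _ → refl }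

constHom₂ : ℤ.+-*-rawRing -Raw-AlmostCommutative⟶ fromCommutativeRing Bivariate.powerSeriesRing
constHom₂ = record
  { ⟦_⟧ = λ x → const₂ (const x)
  ; +-homo = λ x y i j → ≡.trans (Bivariate.const-cong (Univariate.const-+ x y) i j) (Bivariate.const-+ _ _ i j)
  ; *-homo = λ x y i j → ≡.trans (Bivariate.const-cong (Univariate.const-* x y) i j) (Bivariate.const-* _ _ i j)
  ; -‿homo = λ x i j → ≡.trans (Bivariate.const-cong (Univariate.const-neg x) i j) (Bivariate.const-neg _ i j)
  ; 0-homo = λ _ _ → refl ; 1-homo = λ _ _ → refl }

decideConst₁ : ∀ x y → Maybe (Induced-equivalence constHom₁ x y)
decideConst₁ x y with x ℤ.≟ y
... | yes refl = just (λ _ → refl)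
... | no _     = nothing

decideConst₂ : ∀ x y → Maybe (Induced-equivalence constHom₂ x y)
decideConst₂ x y with x ℤ.≟ y
... | yes refl = just (λ _ _ → refl)
... | no _     = nothing

module UnivariateSolver =
  Algebra.Solver.Ring ℤ.+-*-rawRing (fromCommutativeRing Univariate.powerSeriesRing) constHom₁ decideConst₁
module BivariateSolver =
  Algebra.Solver.Ring ℤ.+-*-rawRing (fromCommutativeRing Bivariate.powerSeriesRing) constHom₂ decideConst₂

open UnivariateSolver using (solve; _:=_; _:+_; _:-_; _:*_; :-_; con)
open BivariateSolver using ()
  renaming (solve to solve₂; _:=_ to _:=₂_; _:+_ to _:+₂_; _:-_ to _:-₂_; _:*_ to _:*₂_; con to con₂)

module SeriesRing         = CommutativeRing Univariate.powerSeriesRing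
module BivariateRing      = CommutativeRing Bivariate.powerSeriesRing
module SeriesReasoning    = Relation.Binary.Reasoning.Setoid SeriesRing.setoid
module BivariateReasoning = Relation.Binary.Reasoning.Setoid BivariateRing.setoid

1ₛ : Series
1ₛ = const 1ℤ

-- Cancellation and square roots in ℤ[[t]]; the series z and Q

⊠-leading : ∀ f g k → (∀ a → a < k → f a ≡ 0ℤ) → (f ⊠ g) k ≡ f k ℤ.* g 0
⊠-leading f g zero    _       = refl
⊠-leading f g (suc n) f<k≡0 = begin
  sum≤ (λ a → f a ℤ.* g (suc n ∸ a)) n ℤ.+ f (suc n) ℤ.* g (n ∸ n)
    ≡⟨ ≡.cong₂ ℤ._+_ (Univariate.sum≤-zero _ n (λ a a≤n → ≡.cong (ℤ._* g (suc n ∸ a)) (f<k≡0 a (s≤s a≤n))))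
                     (≡.cong (λ m → f (suc n) ℤ.* g m) (ℕP.n∸n≡0 n)) ⟩
  0ℤ ℤ.+ f (suc n) ℤ.* g 0
    ≡⟨ ℤP.+-identityˡ _ ⟩
  f (suc n) ℤ.* g 0 ∎
  where open ≡.≡-Reasoning

⊠-annihilator : ∀ f g → g 0 ≢ 0ℤ → (∀ k → (f ⊠ g) k ≡ 0ℤ) → ∀ k → f k ≡ 0ℤ
⊠-annihilator f g g₀≢0 fg≡0 = <-rec _ step
  where
  step : ∀ k → (∀ {a} → a < k → f a ≡ 0ℤ) → f k ≡ 0ℤ
  step k ih with ℤP.i*j≡0⇒i≡0∨j≡0 (f k) (≡.trans (≡.sym (⊠-leading f g k (λ a → ih))) (fg≡0 k))
  ... | inj₁ fₖ≡0 = fₖ≡0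
  ... | inj₂ g₀≡0 = contradiction g₀≡0 g₀≢0

⊠-cancelʳ : ∀ f g h → h 0 ≢ 0ℤ → f ⊠ h ≋ g ⊠ h → f ≋ g
⊠-cancelʳ f g h h₀≢0 fh≋gh k = ℤP.i-j≡0⇒i≡j _ _ (⊠-annihilator (f ⊞ ⊟ g) h h₀≢0 difference k)
  where
  distrib : (f ⊞ ⊟ g) ⊠ h ≋ f ⊠ h ⊞ ⊟ (g ⊠ h)
  distrib = solve 3 (λ f g h → (f :- g) :* h := f :* h :- g :* h) (λ _ → refl) f g h
  difference : ∀ k → ((f ⊞ ⊟ g) ⊠ h) k ≡ 0ℤ
  difference k = ≡.trans (distrib k) (ℤP.i≡j⇒i-j≡0 (fh≋gh k))

square-root-unique : ∀ f g → f 0 ≡ g 0 → f 0 ≢ 0ℤ → f ⊠ f ≋ g ⊠ g → f ≋ g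
square-root-unique f g f₀≡g₀ f₀≢0 ff≋gg = ⊠-cancelʳ f g (f ⊞ g) sum₀≢0 λ k → begin
  (f ⊠ (f ⊞ g)) k       ≡⟨ solve 2 (λ f g → f :* (f :+ g) := f :* f :+ f :* g) (λ _ → refl) f g k ⟩
  (f ⊠ f ⊞ f ⊠ g) k     ≡⟨ ≡.cong (ℤ._+ (f ⊠ g) k) (ff≋gg k) ⟩
  (g ⊠ g ⊞ f ⊠ g) k     ≡⟨ solve 2 (λ f g → g :* g :+ f :* g := g :* (f :+ g)) (λ _ → refl) f g k ⟩
  (g ⊠ (f ⊞ g)) k       ∎
  where
  open ≡.≡-Reasoning
  sum₀≢0 : f 0 ℤ.+ g 0 ≢ 0ℤ
  sum₀≢0 f₀+g₀≡0
    with ℤP.i*j≡0⇒i≡0∨j≡0 (+ 2) (≡.trans (double (f 0)) (≡.trans (≡.cong (λ v → f 0 ℤ.+ v) f₀≡g₀) f₀+g₀≡0))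
    where
    double : ∀ x → + 2 ℤ.* x ≡ x ℤ.+ x
    double = solve-∀
  ... | inj₁ ()
  ... | inj₂ f₀≡0 = f₀≢0 f₀≡0

horner : List ℤ → Series
horner []       = const 0ℤ
horner (c ∷ cs) = const c ⊞ X ⊠ horner cs

poly≋horner : ∀ cs → poly cs ≋ horner cs
poly≋horner []       zero    = refl
poly≋horner []       (suc k) = refl
poly≋horner (c ∷ cs) zero    = ≡.sym (≡.trans (≡.cong (ℤ._+_ c) (X-⊠-zero (horner cs))) (ℤP.+-identityʳ c))
poly≋horner (c ∷ cs) (suc k) = ≡.sym (≡.trans (ℤP.+-identityˡ _) (≡.trans (X-⊠-suc (horner cs) k) (≡.sym (poly≋horner cs k))))

motzkinStep : Series → Series
motzkinStep f = X ⊠ (1ₛ ⊞ f ⊞ f ⊠ f)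

motzkinStep-contractive : ∀ n f g → AgreeBelow n f g → AgreeBelow (suc n) (motzkinStep f) (motzkinStep g)
motzkinStep-contractive n f g f≡g zero    _         =
  ≡.trans (X-⊠-zero (1ₛ ⊞ f ⊞ f ⊠ f)) (≡.sym (X-⊠-zero (1ₛ ⊞ g ⊞ g ⊠ g)))
motzkinStep-contractive n f g f≡g (suc k) (s≤s k<n) = begin
  motzkinStep f (suc k)                                       ≡⟨ X-⊠-suc (1ₛ ⊞ f ⊞ f ⊠ f) k ⟩
  1ₛ k ℤ.+ f k ℤ.+ sum≤ (λ a → f a ℤ.* f (k ∸ a)) k
    ≡⟨ ≡.cong₂ (λ u v → 1ₛ k ℤ.+ u ℤ.+ v) (f≡g k k<n) (Univariate.sum≤-cong k (λ a a≤k →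
         ≡.cong₂ ℤ._*_ (f≡g a (ℕP.≤-<-trans a≤k k<n)) (f≡g (k ∸ a) (ℕP.≤-<-trans (ℕP.m∸n≤m k a) k<n)))) ⟩
  1ₛ k ℤ.+ g k ℤ.+ sum≤ (λ a → g a ℤ.* g (k ∸ a)) k           ≡⟨ X-⊠-suc (1ₛ ⊞ g ⊞ g ⊠ g) k ⟨
  motzkinStep g (suc k)                                       ∎
  where open ≡.≡-Reasoning

-- z = t M(t) for the Motzkin series M; it is the root y = z(t) of the kernel y − t(1 + y + y²).
open FixedPoint motzkinStep motzkinStep-contractive (const 0ℤ)
  using () renaming (fix to z; fix-unfold to z-unfold)

z-zero : z 0 ≡ 0ℤ
z-zero = ≡.trans (z-unfold 0) (X-⊠-zero (1ₛ ⊞ z ⊞ z ⊠ z))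

Qz : Series
Qz = 1ₛ ⊞ ⊟ X ⊞ ⊟ (const (+ 2) ⊠ (X ⊠ z))

z-root : z ⊞ ⊟ motzkinStep z ≋ const 0ℤ
z-root zero    = ℤP.i≡j⇒i-j≡0 (z-unfold 0)
z-root (suc k) = ℤP.i≡j⇒i-j≡0 (z-unfold (suc k))

Qz-square : Qz ⊠ Qz ≋ poly (1ℤ ∷ - (+ 2) ∷ - (+ 3) ∷ [])
Qz-square = begin
  Qz ⊠ Qz                                                ≈⟨ SeriesRing.+-identityʳ (Qz ⊠ Qz) ⟨
  Qz ⊠ Qz ⊞ const 0ℤ
    ≈⟨ SeriesRing.+-congˡ {Qz ⊠ Qz} (SeriesRing.trans (SeriesRing.*-congˡ {const (+ 4) ⊠ X} z-root)
                                                        (SeriesRing.zeroʳ (const (+ 4) ⊠ X))) ⟨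
  Qz ⊠ Qz ⊞ const (+ 4) ⊠ X ⊠ (z ⊞ ⊟ motzkinStep z)
    ≈⟨ solve 2 (λ x z → (con 1ℤ :- x :- con (+ 2) :* (x :* z)) :* (con 1ℤ :- x :- con (+ 2) :* (x :* z))
                          :+ con (+ 4) :* x :* (z :- x :* (con 1ℤ :+ z :+ z :* z))
                        := con 1ℤ :+ x :* (con (- (+ 2)) :+ x :* (con (- (+ 3)) :+ x :* con 0ℤ)))
               (λ _ → refl) X z ⟩
  horner (1ℤ ∷ - (+ 2) ∷ - (+ 3) ∷ [])                   ≈⟨ poly≋horner (1ℤ ∷ - (+ 2) ∷ - (+ 3) ∷ []) ⟨
  poly (1ℤ ∷ - (+ 2) ∷ - (+ 3) ∷ [])                     ∎
  where open SeriesReasoning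

1≢0 : ∀ {x} → x ≡ 1ℤ → x ≢ 0ℤ
1≢0 refl ()

negateX-quadratic : ∀ a b c → negateX (poly (a ∷ b ∷ c ∷ [])) ≋ poly (a ∷ - b ∷ c ∷ [])
negateX-quadratic a b c zero                = refl
negateX-quadratic a b c (suc zero)          = refl
negateX-quadratic a b c (suc (suc zero))    = ℤP.neg-involutive c
negateX-quadratic a b c (suc (suc (suc k))) = Univariate.neg^-0# (3 ℕ.+ k)

Q≋Qz : ∀ Q → Q 0 ≡ 1ℤ → Q ⊛ Q ≈₁ poly (1ℤ ∷ - (+ 2) ∷ - (+ 3) ∷ []) → Q ≋ Qz
Q≋Qz Q Q₀≡1 QQ≈ = square-root-unique Q Qz Q₀≡1 (1≢0 Q₀≡1)
  (λ k → ≡.trans (≡.sym (⊛≗⊠ Q Q k)) (≡.trans (QQ≈ k) (≡.sym (Qz-square k))))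

R≋negateX-Q : ∀ Q R → Q 0 ≡ 1ℤ → Q ⊛ Q ≈₁ poly (1ℤ ∷ - (+ 2) ∷ - (+ 3) ∷ []) →
              R 0 ≡ 1ℤ → R ⊛ R ≈₁ poly (1ℤ ∷ + 2 ∷ - (+ 3) ∷ []) → R ≋ negateX Q
R≋negateX-Q Q R Q₀≡1 QQ≈ R₀≡1 RR≈ =
  square-root-unique R (negateX Q) (≡.trans R₀≡1 (≡.sym Q₀≡1)) (1≢0 R₀≡1) λ k → begin
  (R ⊠ R) k                                   ≡⟨ ⊛≗⊠ R R k ⟨
  (R ⊛ R) k                                   ≡⟨ RR≈ k ⟩
  poly (1ℤ ∷ + 2 ∷ - (+ 3) ∷ []) k            ≡⟨ negateX-quadratic _ _ _ k ⟨
  negateX (poly (1ℤ ∷ - (+ 2) ∷ - (+ 3) ∷ [])) k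
    ≡⟨ negateX-cong (λ j → ≡.trans (≡.sym (QQ≈ j)) (⊛≗⊠ Q Q j)) k ⟩
  negateX (Q ⊠ Q) k                           ≡⟨ negateX-⊠ Q Q k ⟩
  (negateX Q ⊠ negateX Q) k                   ∎
  where open ≡.≡-Reasoning

-- Motzkin paths and vertically constrained paths

below : (ℕ → ℕ) → ℕ → ℕ
below f zero    = 0
below f (suc h) = f h

kronecker : ℕ → ℕ → ℕ
kronecker zero    zero    = 1
kronecker zero    (suc _) = 0
kronecker (suc _) zero    = 0
kronecker (suc h) (suc m) = kronecker h m

-- motzkin k h m counts paths with k steps in {(1,1),(1,0),(1,−1)} from height h to height m staying at y ≥ 0.
motzkin : ℕ → ℕ → ℕ → ℕ
motzkin zero    h m = kronecker h m
motzkin (suc k) h m = motzkin k h m ℕ.+ (motzkin k (suc h) m ℕ.+ below (λ h′ → motzkin k h′ m) h)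

twice : ℕ → ℕ
twice zero    = zero
twice (suc n) = suc (suc (twice n))

emptyIf : ℕ → ℕ → List Path
emptyIf zero    zero    = [] ∷ []
emptyIf zero    (suc _) = []
emptyIf (suc _) zero    = []
emptyIf (suc h) (suc m) = emptyIf h m

stepDown : Step → (ℕ → List Path) → ℕ → List Path
stepDown s f zero    = []
stepDown s f (suc h) = map (s ∷_) (f h)

-- smPaths n h m and paths n h m list the vertically constrained paths with n horizontal steps from
-- height h to height m staying at y ≥ 0; those in smPaths do not start with a vertical step.
smPaths paths : ℕ → ℕ → ℕ → List Path
smPaths zero    h m = emptyIf h m
smPaths (suc n) h m =
  map (E ∷_) (paths n h m) ++ (map (U ∷_) (paths n (suc h) m) ++ stepDown D (λ h′ → paths n h′ m) h)
paths n h m =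
  smPaths n h m ++ (map (N ∷_) (smPaths n (suc h) m) ++ stepDown S (λ h′ → smPaths n h′ m) h)

length-emptyIf : ∀ h m → length (emptyIf h m) ≡ kronecker h m
length-emptyIf zero    zero    = refl
length-emptyIf zero    (suc m) = refl
length-emptyIf (suc h) zero    = refl
length-emptyIf (suc h) (suc m) = length-emptyIf h m

length-stepDown : ∀ s f g → (∀ h → length (f h) ≡ g h) → ∀ h → length (stepDown s f h) ≡ below g h
length-stepDown s f g eq zero    = refl
length-stepDown s f g eq (suc h) = ≡.trans (ListP.length-map (s ∷_) (f h)) (eq h)

length-three : ∀ (s t : Step) xs ys zs →
               length (map (s ∷_) xs ++ (map (t ∷_) ys ++ zs)) ≡ length xs ℕ.+ (length ys ℕ.+ length zs)
length-three s t xs ys zs = begin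
  length (map (s ∷_) xs ++ (map (t ∷_) ys ++ zs))
    ≡⟨ ListP.length-++ (map (s ∷_) xs) ⟩
  length (map (s ∷_) xs) ℕ.+ length (map (t ∷_) ys ++ zs)
    ≡⟨ ≡.cong₂ ℕ._+_ (ListP.length-map (s ∷_) xs) (ListP.length-++ (map (t ∷_) ys)) ⟩
  length xs ℕ.+ (length (map (t ∷_) ys) ℕ.+ length zs)
    ≡⟨ ≡.cong (λ l → length xs ℕ.+ (l ℕ.+ length zs)) (ListP.length-map (t ∷_) ys) ⟩
  length xs ℕ.+ (length ys ℕ.+ length zs) ∎
  where open ≡.≡-Reasoning

length-smPaths : ∀ n h m → length (smPaths n h m) ≡ motzkin (twice n) h m
length-paths   : ∀ n h m → length (paths n h m) ≡ motzkin (suc (twice n)) h m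
length-smPaths zero    h m = length-emptyIf h m
length-smPaths (suc n) h m =
  ≡.trans (length-three E U (paths n h m) (paths n (suc h) m) (stepDown D (λ h′ → paths n h′ m) h))
    (≡.cong₂ ℕ._+_ (length-paths n h m) (≡.cong₂ ℕ._+_ (length-paths n (suc h) m)
      (length-stepDown D (λ h′ → paths n h′ m) _ (λ h′ → length-paths n h′ m) h)))
length-paths n h m = ≡.trans (ListP.length-++ (smPaths n h m))
  (≡.cong₂ ℕ._+_ (length-smPaths n h m) (≡.trans (ListP.length-++ (map (N ∷_) (smPaths n (suc h) m)))
    (≡.cong₂ ℕ._+_ (≡.trans (ListP.length-map (N ∷_) (smPaths n (suc h) m)) (length-smPaths n (suc h) m))
      (length-stepDown S (λ h′ → smPaths n h′ m) _ (λ h′ → length-smPaths n h′ m) h))))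

IsPathFrom : ℕ → ℕ → ℕ → Path → Set
IsPathFrom n h m p = VertConstrained p × NonnegFrom (+ h) p × endX p ≡ + n × + h ℤ.+ endY p ≡ + m

IsSMPathFrom : ℕ → ℕ → ℕ → Path → Set
IsSMPathFrom n h m p = IsPathFrom n h m p × FirstInSM p

record Moves (s : Step) (h h′ : ℕ) : Set where
  constructor moves
  field height : + h ℤ.+ dy s ≡ + h′

moves-E : ∀ h → Moves E h h
moves-E h = moves (ℤP.+-identityʳ (+ h))

moves-U : ∀ h → Moves U h (suc h)
moves-U h = moves (≡.trans (≡.sym (ℤP.pos-+ h 1)) (≡.cong +_ (ℕP.+-comm h 1)))

moves-N : ∀ h → Moves N h (suc h)
moves-N h = moves (Moves.height (moves-U h))

moves-D : ∀ h → Moves D (suc h) h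
moves-D h = moves refl

moves-S : ∀ h → Moves S (suc h) h
moves-S h = moves refl

vc-∷-horizontal : ∀ {s q} → vertical s ≡ false → VertConstrained q → VertConstrained (s ∷ q)
vc-∷-horizontal {s} {[]}    hor vc = vc-one s
vc-∷-horizontal {s} {t ∷ q} hor vc = vc-cons s t q (≡.cong (_∧ vertical t) hor) vc

vc-∷-vertical : ∀ {s q} → FirstInSM q → VertConstrained q → VertConstrained (s ∷ q)
vc-∷-vertical {s} {[]}    _   vc = vc-one s
vc-∷-vertical {s} {t ∷ q} hor vc = vc-cons s t q (≡.trans (≡.cong (vertical s ∧_) hor) (BoolP.∧-zeroʳ (vertical s))) vc

vc-tail : ∀ {s q} → VertConstrained (s ∷ q) → VertConstrained q
vc-tail (vc-one s)           = vc-nil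
vc-tail (vc-cons s t q _ vc) = vc

vc-after-vertical : ∀ {s q} → vertical s ≡ true → VertConstrained (s ∷ q) → FirstInSM q
vc-after-vertical ver (vc-one s)            = tt
vc-after-vertical ver (vc-cons s t q ¬vv _) = ≡.trans (≡.cong (_∧ vertical t) (≡.sym ver)) ¬vv

nonneg-∷⁺ : ∀ {s h h′ q} → Moves s h h′ → NonnegFrom (+ h′) q → NonnegFrom (+ h) (s ∷ q)
nonneg-∷⁺ (moves mv) nn = ≡.subst (0ℤ ℤ.≤_) (≡.sym mv) (ℤ.+≤+ z≤n) , ≡.subst (λ x → NonnegFrom x _) (≡.sym mv) nn

nonneg-∷⁻ : ∀ {s h h′ q} → Moves s h h′ → NonnegFrom (+ h) (s ∷ q) → NonnegFrom (+ h′) q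
nonneg-∷⁻ (moves mv) (_ , nn) = ≡.subst (λ x → NonnegFrom x _) mv nn

endY-∷⁺ : ∀ {s h h′ m} q → Moves s h h′ → + h′ ℤ.+ endY q ≡ + m → + h ℤ.+ endY (s ∷ q) ≡ + m
endY-∷⁺ {s} {h} q (moves mv) ey = ≡.trans (≡.sym (ℤP.+-assoc (+ h) (dy s) (endY q))) (≡.trans (≡.cong (ℤ._+ endY q) mv) ey)

endY-∷⁻ : ∀ {s h h′ m} q → Moves s h h′ → + h ℤ.+ endY (s ∷ q) ≡ + m → + h′ ℤ.+ endY q ≡ + m
endY-∷⁻ {s} {h} q (moves mv) ey = ≡.trans (≡.cong (ℤ._+ endY q) (≡.sym mv)) (≡.trans (ℤP.+-assoc (+ h) (dy s) (endY q)) ey)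

horizontalSteps : Path → ℕ
horizontalSteps []      = 0
horizontalSteps (s ∷ q) with vertical s
... | true  = horizontalSteps q
... | false = suc (horizontalSteps q)

endX≡horizontalSteps : ∀ q → endX q ≡ + horizontalSteps q
endX≡horizontalSteps []      = refl
endX≡horizontalSteps (E ∷ q) = ≡.cong (ℤ._+_ (+ 1)) (endX≡horizontalSteps q)
endX≡horizontalSteps (U ∷ q) = ≡.cong (ℤ._+_ (+ 1)) (endX≡horizontalSteps q)
endX≡horizontalSteps (D ∷ q) = ≡.cong (ℤ._+_ (+ 1)) (endX≡horizontalSteps q)
endX≡horizontalSteps (N ∷ q) = ≡.cong (ℤ._+_ 0ℤ) (endX≡horizontalSteps q)
endX≡horizontalSteps (S ∷ q) = ≡.cong (ℤ._+_ 0ℤ) (endX≡horizontalSteps q)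

horizontal-∷⁺ : ∀ {s n h h′ m q} → Moves s h h′ → dx s ≡ + 1 → vertical s ≡ false →
                IsPathFrom n h′ m q → IsSMPathFrom (suc n) h m (s ∷ q)
horizontal-∷⁺ {q = q} mv dx≡1 hor (vc , nn , ex , ey) =
  (vc-∷-horizontal hor vc , nonneg-∷⁺ mv nn , ≡.cong₂ ℤ._+_ dx≡1 ex , endY-∷⁺ q mv ey) , hor

horizontal-∷⁻ : ∀ {s n h h′ m q} → Moves s h h′ → dx s ≡ + 1 →
                IsPathFrom n h m (s ∷ q) → Σ ℕ λ n′ → n ≡ suc n′ × IsPathFrom n′ h′ m q
horizontal-∷⁻ {q = q} mv dx≡1 (vc , nn , ex , ey) =
  horizontalSteps q
  , ≡.sym (ℤP.+-injective (≡.trans (≡.sym (≡.cong₂ ℤ._+_ dx≡1 (endX≡horizontalSteps q))) ex))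
  , vc-tail vc , nonneg-∷⁻ mv nn , endX≡horizontalSteps q , endY-∷⁻ q mv ey

vertical-∷⁺ : ∀ {s n h h′ m q} → Moves s h h′ → dx s ≡ 0ℤ → IsSMPathFrom n h′ m q → IsPathFrom n h m (s ∷ q)
vertical-∷⁺ {q = q} mv dx≡0 ((vc , nn , ex , ey) , first) =
  vc-∷-vertical first vc , nonneg-∷⁺ mv nn , ≡.trans (≡.cong₂ ℤ._+_ dx≡0 ex) (ℤP.+-identityˡ _) , endY-∷⁺ q mv ey

vertical-∷⁻ : ∀ {s n h h′ m q} → Moves s h h′ → dx s ≡ 0ℤ → vertical s ≡ true →
              IsPathFrom n h m (s ∷ q) → IsSMPathFrom n h′ m q
vertical-∷⁻ {q = q} mv dx≡0 ver (vc , nn , ex , ey) =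
  (vc-tail vc , nonneg-∷⁻ mv nn , ≡.trans (≡.sym (ℤP.+-identityˡ (endX q))) (≡.trans (≡.cong (ℤ._+ endX q) (≡.sym dx≡0)) ex)
  , endY-∷⁻ q mv ey) , vc-after-vertical ver vc

emptyIf-members : ∀ h m → All (λ p → p ≡ [] × h ≡ m) (emptyIf h m)
emptyIf-members zero    zero    = (refl , refl) All.∷ All.[]
emptyIf-members zero    (suc m) = All.[]
emptyIf-members (suc h) zero    = All.[]
emptyIf-members (suc h) (suc m) = All.map (λ (p≡[] , h≡m) → p≡[] , ≡.cong suc h≡m) (emptyIf-members h m)

emptyIf-sound : ∀ h m → All (IsSMPathFrom 0 h m) (emptyIf h m)
emptyIf-sound h m = All.map (λ { (refl , refl) → (vc-nil , tt , refl , ℤP.+-identityʳ (+ h)) , tt }) (emptyIf-members h m)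

stepDown-sound : ∀ s {P Q : ℕ → Path → Set} (f : ℕ → List Path) →
                 (∀ h {q} → P h q → Q (suc h) (s ∷ q)) → (∀ h → All (P h) (f h)) → ∀ h → All (Q h) (stepDown s f h)
stepDown-sound s f cons sound zero    = All.[]
stepDown-sound s f cons sound (suc h) = AllP.map⁺ (All.map (cons h) (sound h))

smPaths-sound : ∀ n h m → All (IsSMPathFrom n h m) (smPaths n h m)
paths-sound   : ∀ n h m → All (IsPathFrom n h m) (paths n h m)
smPaths-sound zero    h m = emptyIf-sound h m
smPaths-sound (suc n) h m = AllP.++⁺
  (AllP.map⁺ (All.map (horizontal-∷⁺ (moves-E h) refl refl) (paths-sound n h m)))
  (AllP.++⁺ (AllP.map⁺ (All.map (horizontal-∷⁺ (moves-U h) refl refl) (paths-sound n (suc h) m)))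
            (stepDown-sound D {Q = λ h′ → IsSMPathFrom (suc n) h′ m} _ (λ h′ → horizontal-∷⁺ (moves-D h′) refl refl)
                            (λ h′ → paths-sound n h′ m) h))
paths-sound n h m = AllP.++⁺ (All.map proj₁ (smPaths-sound n h m))
  (AllP.++⁺ (AllP.map⁺ (All.map (vertical-∷⁺ (moves-N h) refl) (smPaths-sound n (suc h) m)))
            (stepDown-sound S {Q = λ h′ → IsPathFrom n h′ m} _ (λ h′ → vertical-∷⁺ (moves-S h′) refl)
                            (λ h′ → smPaths-sound n h′ m) h))

[]∈emptyIf : ∀ h → [] ∈ emptyIf h h
[]∈emptyIf zero    = here refl
[]∈emptyIf (suc h) = []∈emptyIf h

smPaths-complete : ∀ n h m p → IsSMPathFrom n h m p → p ∈ smPaths n h m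
paths-complete   : ∀ n h m p → IsPathFrom n h m p → p ∈ paths n h m
smPaths-complete n h m [] ((_ , _ , refl , ey) , _) =
  ≡.subst (λ m → [] ∈ emptyIf h m) (ℤP.+-injective (≡.trans (≡.sym (ℤP.+-identityʳ (+ h))) ey)) ([]∈emptyIf h)
smPaths-complete n h m (E ∷ q) (valid , _) with horizontal-∷⁻ (moves-E h) refl valid
... | n′ , refl , valid′ = ∈-++⁺ˡ (∈-map⁺ (E ∷_) (paths-complete n′ h m q valid′))
smPaths-complete n h m (U ∷ q) (valid , _) with horizontal-∷⁻ (moves-U h) refl valid
... | n′ , refl , valid′ = ∈-++⁺ʳ (map (E ∷_) (paths n′ h m))
  (∈-++⁺ˡ (∈-map⁺ (U ∷_) (paths-complete n′ (suc h) m q valid′)))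
smPaths-complete n zero    m (D ∷ q) ((_ , (() , _) , _) , _)
smPaths-complete n (suc h) m (D ∷ q) (valid , _) with horizontal-∷⁻ (moves-D h) refl valid
... | n′ , refl , valid′ = ∈-++⁺ʳ (map (E ∷_) (paths n′ (suc h) m))
  (∈-++⁺ʳ (map (U ∷_) (paths n′ (suc (suc h)) m)) (∈-map⁺ (D ∷_) (paths-complete n′ h m q valid′)))
smPaths-complete n h m (N ∷ q) (_ , ())
smPaths-complete n h m (S ∷ q) (_ , ())
paths-complete n h m []      valid = ∈-++⁺ˡ (smPaths-complete n h m [] (valid , tt))
paths-complete n h m (E ∷ q) valid = ∈-++⁺ˡ (smPaths-complete n h m (E ∷ q) (valid , refl))
paths-complete n h m (U ∷ q) valid = ∈-++⁺ˡ (smPaths-complete n h m (U ∷ q) (valid , refl))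
paths-complete n h m (D ∷ q) valid = ∈-++⁺ˡ (smPaths-complete n h m (D ∷ q) (valid , refl))
paths-complete n h m (N ∷ q) valid = ∈-++⁺ʳ (smPaths n h m)
  (∈-++⁺ˡ (∈-map⁺ (N ∷_) (smPaths-complete n (suc h) m q (vertical-∷⁻ (moves-N h) refl refl valid))))
paths-complete n zero    m (S ∷ q) (_ , (() , _) , _)
paths-complete n (suc h) m (S ∷ q) valid = ∈-++⁺ʳ (smPaths n (suc h) m)
  (∈-++⁺ʳ (map (N ∷_) (smPaths n (suc (suc h)) m))
    (∈-map⁺ (S ∷_) (smPaths-complete n h m q (vertical-∷⁻ (moves-S h) refl refl valid))))

firstStep : Path → Maybe Step
firstStep []      = nothing
firstStep (s ∷ _) = just s

StartsWith : Step → Path → Set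
StartsWith s p = firstStep p ≡ just s

startsWith-distinct : ∀ {s t p} → s ≢ t → StartsWith s p → ¬ StartsWith t p
startsWith-distinct s≢t sp tp = s≢t (just-injective (≡.trans (≡.sym sp) tp))

startsVertical⇒¬FirstInSM : ∀ {s p} → vertical s ≡ true → StartsWith s p → ¬ FirstInSM p
startsVertical⇒¬FirstInSM {p = t ∷ _} ver refl first with ≡.trans (≡.sym ver) first
... | ()

map-∷-startsWith : ∀ s xs → All (StartsWith s) (map (s ∷_) xs)
map-∷-startsWith s xs = AllP.map⁺ (All.universal (λ _ → refl) xs)

stepDown-startsWith : ∀ s f h → All (StartsWith s) (stepDown s f h)
stepDown-startsWith s f zero    = All.[]
stepDown-startsWith s f (suc h) = map-∷-startsWith s (f h)

disjoint : ∀ {P Q : Path → Set} {xs ys} → All P xs → All Q ys → (∀ {p} → P p → Q p → ⊥) → Disjoint xs ys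
disjoint Pxs Qys P∩Q=∅ (v∈xs , v∈ys) = P∩Q=∅ (All.lookup Pxs v∈xs) (All.lookup Qys v∈ys)

map-∷-unique : ∀ (s : Step) {xs : List Path} → Unique xs → Unique (map (s ∷_) xs)
map-∷-unique s = UniqueP.map⁺ ListP.∷-injectiveʳ

stepDown-unique : ∀ s (f : ℕ → List Path) → (∀ h → Unique (f h)) → ∀ h → Unique (stepDown s f h)
stepDown-unique s f unique zero    = AllPairs.[]
stepDown-unique s f unique (suc h) = map-∷-unique s (unique h)

emptyIf-unique : ∀ h m → Unique (emptyIf h m)
emptyIf-unique zero    zero    = All.[] AllPairs.∷ AllPairs.[]
emptyIf-unique zero    (suc m) = AllPairs.[]
emptyIf-unique (suc h) zero    = AllPairs.[]
emptyIf-unique (suc h) (suc m) = emptyIf-unique h m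

smPaths-unique : ∀ n h m → Unique (smPaths n h m)
paths-unique   : ∀ n h m → Unique (paths n h m)
smPaths-unique zero    h m = emptyIf-unique h m
smPaths-unique (suc n) h m = UniqueP.++⁺ (map-∷-unique E (paths-unique n h m))
  (UniqueP.++⁺ (map-∷-unique U (paths-unique n (suc h) m)) (stepDown-unique D _ (λ h′ → paths-unique n h′ m) h)
    (disjoint (map-∷-startsWith U _) (stepDown-startsWith D _ h) (startsWith-distinct λ ())))
  (disjoint (map-∷-startsWith E _)
    (AllP.++⁺ (All.map (startsWith-distinct λ ()) (map-∷-startsWith U _))
              (All.map (startsWith-distinct λ ()) (stepDown-startsWith D _ h)))
    (λ sE ¬sE → ¬sE sE))
paths-unique n h m = UniqueP.++⁺ (smPaths-unique n h m)
  (UniqueP.++⁺ (map-∷-unique N (smPaths-unique n (suc h) m)) (stepDown-unique S _ (λ h′ → smPaths-unique n h′ m) h)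
    (disjoint (map-∷-startsWith N _) (stepDown-startsWith S _ h) (startsWith-distinct λ ())))
  (disjoint (All.map proj₂ (smPaths-sound n h m))
    (AllP.++⁺ (All.map (startsVertical⇒¬FirstInSM refl) (map-∷-startsWith N _))
              (All.map (startsVertical⇒¬FirstInSM refl) (stepDown-startsWith S _ h)))
    (λ first ¬first → ¬first first))


HasSize⇒≡length : ∀ {P : Path → Set} {c} → HasSize P c →
                  ∀ ys → Unique ys → All P ys → (∀ p → P p → p ∈ ys) → c ≡ length ys
HasSize⇒≡length (xs , xs-unique , xs-sound , xs-complete , length≡c) ys ys-unique ys-sound ys-complete =
  ≡.trans (≡.sym length≡c) (↭-length (∼bag⇒↭ (unique∧set⇒bag xs-unique ys-unique
    (mk⇔ (λ x∈ → ys-complete _ (All.lookup xs-sound x∈)) (λ y∈ → xs-complete _ (All.lookup ys-sound y∈))))))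

IsPathFrom0⇔IsAQPath : ∀ {n m p} → (IsPathFrom n 0 m p → IsAQPath n m p) × (IsAQPath n m p → IsPathFrom n 0 m p)
IsPathFrom0⇔IsAQPath {p = p} =
  (λ (vc , nn , ex , ey) → vc , nn , ex , ≡.trans (≡.sym (ℤP.+-identityˡ (endY p))) ey) ,
  (λ (vc , nn , ex , ey) → vc , nn , ex , ≡.trans (ℤP.+-identityˡ (endY p)) ey)

aQR≡motzkin : ∀ n m c → HasSize (IsAQRPath n m) c → c ≡ motzkin (twice n) 0 m
aQR≡motzkin n m c size = ≡.trans
  (HasSize⇒≡length size (smPaths n 0 m) (smPaths-unique n 0 m)
    (All.map (λ (valid , first) → proj₁ IsPathFrom0⇔IsAQPath valid , first) (smPaths-sound n 0 m))
    (λ p (valid , first) → smPaths-complete n 0 m p (proj₂ IsPathFrom0⇔IsAQPath valid , first)))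
  (length-smPaths n 0 m)

aQ≡motzkin : ∀ n m c → HasSize (IsAQPath n m) c → c ≡ motzkin (suc (twice n)) 0 m
aQ≡motzkin n m c size = ≡.trans
  (HasSize⇒≡length size (paths n 0 m) (paths-unique n 0 m)
    (All.map (proj₁ IsPathFrom0⇔IsAQPath) (paths-sound n 0 m))
    (λ p valid → paths-complete n 0 m p (proj₂ IsPathFrom0⇔IsAQPath valid)))
  (length-paths n 0 m)

below-cong : ∀ {f g} → (∀ h → f h ≡ g h) → ∀ h → below f h ≡ below g h
below-cong f≡g zero    = refl
below-cong f≡g (suc h) = f≡g h

below-+ : ∀ f g h → below (λ j → f j ℕ.+ g j) h ≡ below f h ℕ.+ below g h
below-+ f g zero    = refl
below-+ f g (suc h) = refl

below-comm : ∀ (f : ℕ → ℕ → ℕ) h m →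
             below (λ m′ → below (λ h′ → f h′ m′) h) m ≡ below (λ h′ → below (f h′) m) h
below-comm f zero    zero    = refl
below-comm f zero    (suc m) = refl
below-comm f (suc h) zero    = refl
below-comm f (suc h) (suc m) = refl

motzkin-suc-last : ∀ k h m → motzkin (suc k) h m ≡ below (motzkin k h) m ℕ.+ motzkin k h m ℕ.+ motzkin k h (suc m)
motzkin-suc-last zero    h m =
  ≡.trans (≡.cong₂ (λ b c → kronecker h m ℕ.+ (b ℕ.+ c)) (kronecker-suc-left h m) (kronecker-suc-right h m))
          (swap (kronecker h m) (below (kronecker h) m) (kronecker h (suc m)))
  where
  kronecker-suc-left : ∀ h m → kronecker (suc h) m ≡ below (kronecker h) m
  kronecker-suc-left h zero    = refl
  kronecker-suc-left h (suc m) = refl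
  kronecker-suc-right : ∀ h m → below (λ h′ → kronecker h′ m) h ≡ kronecker h (suc m)
  kronecker-suc-right zero    m = refl
  kronecker-suc-right (suc h) m = refl
  swap : ∀ a b c → a ℕ.+ (b ℕ.+ c) ≡ b ℕ.+ a ℕ.+ c
  swap = NatSolver.solve-∀
motzkin-suc-last (suc k) h m = begin
  M₁ h m ℕ.+ (M₁ (suc h) m ℕ.+ below (λ h′ → M₁ h′ m) h)
    ≡⟨ ≡.cong₂ ℕ._+_ (motzkin-suc-last k h m) (≡.cong₂ ℕ._+_ (motzkin-suc-last k (suc h) m)
         (≡.trans (below-cong (λ h′ → motzkin-suc-last k h′ m) h)
           (≡.trans (below-+ (λ h′ → below (M h′) m ℕ.+ M h′ m) (λ h′ → M h′ (suc m)) h)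
             (≡.cong (ℕ._+ below (λ h′ → M h′ (suc m)) h) (below-+ (λ h′ → below (M h′) m) (λ h′ → M h′ m) h))))) ⟩
  (below (M h) m ℕ.+ M h m ℕ.+ M h (suc m)) ℕ.+
    ((below (M (suc h)) m ℕ.+ M (suc h) m ℕ.+ M (suc h) (suc m)) ℕ.+
     (below (λ h′ → below (M h′) m) h ℕ.+ below (λ h′ → M h′ m) h ℕ.+ below (λ h′ → M h′ (suc m)) h))
    ≡⟨ rearrange (below (M h) m) (M h m) (M h (suc m)) (below (M (suc h)) m) (M (suc h) m) (M (suc h) (suc m))
                 (below (λ h′ → below (M h′) m) h) (below (λ h′ → M h′ m) h) (below (λ h′ → M h′ (suc m)) h) ⟩
  (below (M h) m ℕ.+ (below (M (suc h)) m ℕ.+ below (λ h′ → below (M h′) m) h)) ℕ.+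
    (M h m ℕ.+ (M (suc h) m ℕ.+ below (λ h′ → M h′ m) h)) ℕ.+
    (M h (suc m) ℕ.+ (M (suc h) (suc m) ℕ.+ below (λ h′ → M h′ (suc m)) h))
    ≡⟨ ≡.cong (λ x → x ℕ.+ M₁ h m ℕ.+ M₁ h (suc m)) (≡.sym (≡.trans
         (below-+ (M h) (λ m′ → M (suc h) m′ ℕ.+ below (λ h′ → M h′ m′) h) m)
         (≡.cong (below (M h) m ℕ.+_) (≡.trans (below-+ (M (suc h)) (λ m′ → below (λ h′ → M h′ m′) h) m)
           (≡.cong (below (M (suc h)) m ℕ.+_) (below-comm M h m)))))) ⟩
  below (M₁ h) m ℕ.+ M₁ h m ℕ.+ M₁ h (suc m) ∎
  where
  open ≡.≡-Reasoning
  M M₁ : ℕ → ℕ → ℕ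
  M  = motzkin k
  M₁ = motzkin (suc k)
  rearrange : ∀ a b c d e f g h i → (a ℕ.+ b ℕ.+ c) ℕ.+ ((d ℕ.+ e ℕ.+ f) ℕ.+ (g ℕ.+ h ℕ.+ i))
                                  ≡ (a ℕ.+ (d ℕ.+ g)) ℕ.+ (b ℕ.+ (e ℕ.+ h)) ℕ.+ (c ℕ.+ (f ℕ.+ i))
  rearrange = NatSolver.solve-∀

-- The kernel method

Y : Series₂
Y = const₂ X

column₀ : Series₂ → Series
column₀ F i = F i 0

lift-row : ∀ f i → lift f i ≋ const (f i)
lift-row f i zero    = refl
lift-row f i (suc j) = refl

T-⊠-zero : ∀ F → (T ⊠₂ F) 0 ≋ const 0ℤ
T-⊠-zero F = Bivariate.X-⊠-zero F

T-⊠-suc : ∀ F i → (T ⊠₂ F) (suc i) ≋ F i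
T-⊠-suc F i = Bivariate.X-⊠-suc F i

const₂-⊠ : ∀ f F i → (const₂ f ⊠₂ F) i ≋ f ⊠ F i
const₂-⊠ f F i = Bivariate.const-⊠ f F i

lift-⊠₂-coeff : ∀ f F i j → (lift f ⊠₂ F) i j ≡ sum≤ (λ a → f a ℤ.* F (i ∸ a) j) i
lift-⊠₂-coeff f F i j = ≡.trans (≡.sym (⊛₂≗⊠₂ (lift f) F i j))
  (≡.trans (sumTo-cong i (λ a → ≡.trans (⊛≗⊠ (lift f a) (F (i ∸ a)) j)
     (≡.trans (⊠-cong {g = F (i ∸ a)} (lift-row f a) (λ _ → refl) j) (Univariate.const-⊠ (f a) (F (i ∸ a)) j))))
    (sumTo≡sum≤ _ i))

G : Series₂
G i j = + motzkin i 0 j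

G-zero : G 0 ≋ 1ₛ
G-zero zero    = refl
G-zero (suc j) = refl

G-suc : ∀ i → G (suc i) ≋ G i ⊞ tail (G i) ⊞ X ⊠ G i
G-suc i m = begin
  + motzkin (suc i) 0 m
    ≡⟨ ≡.cong +_ (motzkin-suc-last i 0 m) ⟩
  + (below (motzkin i 0) m ℕ.+ motzkin i 0 m ℕ.+ motzkin i 0 (suc m))
    ≡⟨ ≡.trans (ℤP.pos-+ (below (motzkin i 0) m ℕ.+ motzkin i 0 m) _)
               (≡.cong (ℤ._+ G i (suc m)) (ℤP.pos-+ (below (motzkin i 0) m) _)) ⟩
  + below (motzkin i 0) m ℤ.+ G i m ℤ.+ G i (suc m)
    ≡⟨ rotate (+ below (motzkin i 0) m) (G i m) (G i (suc m)) ⟩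
  G i m ℤ.+ G i (suc m) ℤ.+ + below (motzkin i 0) m
    ≡⟨ ≡.cong (ℤ._+_ (G i m ℤ.+ G i (suc m))) (≡.sym (X-⊠-below m)) ⟩
  G i m ℤ.+ G i (suc m) ℤ.+ (X ⊠ G i) m ∎
  where
  open ≡.≡-Reasoning
  rotate : ∀ a b c → a ℤ.+ b ℤ.+ c ≡ b ℤ.+ c ℤ.+ a
  rotate = solve-∀
  X-⊠-below : ∀ m → (X ⊠ G i) m ≡ + below (motzkin i 0) m
  X-⊠-below zero    = X-⊠-zero (G i)
  X-⊠-below (suc m) = X-⊠-suc (G i) m

1₂ : Series₂
1₂ = const₂ 1ₛ

kernel : Series₂
kernel = Y ⊞₂ ⊟₂ (T ⊠₂ (1₂ ⊞₂ Y ⊞₂ Y ⊠₂ Y))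

kernel-equation : G ⊠₂ kernel ≋₂ Y ⊞₂ ⊟₂ (T ⊠₂ lift (column₀ G))
kernel-equation i = SeriesRing.trans (expand i) (row i)
  where
  open SeriesReasoning
  step : Series₂
  step = 1₂ ⊞₂ Y ⊞₂ Y ⊠₂ Y
  expand : G ⊠₂ kernel ≋₂ Y ⊠₂ G ⊞₂ ⊟₂ (T ⊠₂ (step ⊠₂ G))
  expand = solve₂ 3 (λ g y t → g :*₂ (y :-₂ t :*₂ (con₂ 1ℤ :+₂ y :+₂ y :*₂ y))
                             :=₂ y :*₂ g :-₂ t :*₂ ((con₂ 1ℤ :+₂ y :+₂ y :*₂ y) :*₂ g))
                  (λ _ _ → refl) G Y T
  step-row : ∀ i → (step ⊠₂ G) i ≋ (1ₛ ⊞ X ⊞ X ⊠ X) ⊠ G i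
  step-row i = begin
    (step ⊠₂ G) i                           ≈⟨ Bivariate.⊠-cong {g = G} (BivariateRing.sym const₂-step) (λ _ → SeriesRing.refl) i ⟩
    (const₂ (1ₛ ⊞ X ⊞ X ⊠ X) ⊠₂ G) i        ≈⟨ const₂-⊠ (1ₛ ⊞ X ⊞ X ⊠ X) G i ⟩
    (1ₛ ⊞ X ⊞ X ⊠ X) ⊠ G i                  ∎
    where
    const₂-step : const₂ (1ₛ ⊞ X ⊞ X ⊠ X) ≋₂ step
    const₂-step = BivariateRing.trans (Bivariate.const-+ (1ₛ ⊞ X) (X ⊠ X))
      (BivariateRing.+-cong (Bivariate.const-+ 1ₛ X) (Bivariate.const-* X X))
  row : ∀ i → (Y ⊠₂ G ⊞₂ ⊟₂ (T ⊠₂ (step ⊠₂ G))) i ≋ (Y ⊞₂ ⊟₂ (T ⊠₂ lift (column₀ G))) i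
  row zero = begin
    (Y ⊠₂ G) 0 ⊞ ⊟ (T ⊠₂ (step ⊠₂ G)) 0     ≈⟨ SeriesRing.+-cong (const₂-⊠ X G 0) (SeriesRing.-‿cong (T-⊠-zero (step ⊠₂ G))) ⟩
    X ⊠ G 0 ⊞ ⊟ const 0ℤ                    ≈⟨ SeriesRing.+-congʳ (SeriesRing.trans (SeriesRing.*-congˡ {X} G-zero) (SeriesRing.*-identityʳ X)) ⟩
    X ⊞ ⊟ const 0ℤ                          ≈⟨ SeriesRing.+-congˡ {X} (SeriesRing.-‿cong (T-⊠-zero (lift (column₀ G)))) ⟨
    X ⊞ ⊟ (T ⊠₂ lift (column₀ G)) 0         ∎
  row (suc i) = begin
    (Y ⊠₂ G) (suc i) ⊞ ⊟ (T ⊠₂ (step ⊠₂ G)) (suc i)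
      ≈⟨ SeriesRing.+-cong (const₂-⊠ X G (suc i)) (SeriesRing.-‿cong (SeriesRing.trans (T-⊠-suc (step ⊠₂ G) i) (step-row i))) ⟩
    X ⊠ G (suc i) ⊞ ⊟ ((1ₛ ⊞ X ⊞ X ⊠ X) ⊠ G i)
      ≈⟨ SeriesRing.+-congʳ (SeriesRing.*-congˡ {X} (G-suc i)) ⟩
    X ⊠ (g ⊞ tail g ⊞ X ⊠ g) ⊞ ⊟ ((1ₛ ⊞ X ⊞ X ⊠ X) ⊠ g)
      ≈⟨ solve 3 (λ x g tg → x :* (g :+ tg :+ x :* g) :- (con 1ℤ :+ x :+ x :* x) :* g := x :* tg :- g)
               (λ _ → refl) X g (tail g) ⟩
    X ⊠ tail g ⊞ ⊟ g
      ≈⟨ SeriesRing.+-congʳ (Univariate.X-⊠-tail g) ⟩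
    g ⊞ ⊟ const (g 0) ⊞ ⊟ g
      ≈⟨ solve 2 (λ g c → g :- c :- g := con 0ℤ :- c) (λ _ → refl) g (const (g 0)) ⟩
    const 0ℤ ⊞ ⊟ const (g 0)
      ≈⟨ SeriesRing.+-congˡ {const 0ℤ} (SeriesRing.-‿cong (SeriesRing.trans (T-⊠-suc (lift (column₀ G)) i) (lift-row (column₀ G) i))) ⟨
    (Y ⊞₂ ⊟₂ (T ⊠₂ lift (column₀ G))) (suc i) ∎
    where
    g : Series
    g = G i

lift-cong : ∀ {f g} → f ≋ g → lift f ≋₂ lift g
lift-cong f≋g i zero    = f≋g i
lift-cong f≋g i (suc j) = refl

lift-⊞ : ∀ f g → lift (f ⊞ g) ≋₂ lift f ⊞₂ lift g
lift-⊞ f g i zero    = refl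
lift-⊞ f g i (suc j) = refl

lift-⊟ : ∀ f → lift (⊟ f) ≋₂ ⊟₂ lift f
lift-⊟ f i zero    = refl
lift-⊟ f i (suc j) = refl

lift-⊠ : ∀ f g → lift (f ⊠ g) ≋₂ lift f ⊠₂ lift g
lift-⊠ f g i zero    = ≡.sym (lift-⊠₂-coeff f (lift g) i 0)
lift-⊠ f g i (suc j) = ≡.sym (≡.trans (lift-⊠₂-coeff f (lift g) i (suc j))
  (Univariate.sum≤-zero _ i (λ a _ → ℤP.*-zeroʳ (f a))))

lift-const : ∀ c → lift (const c) ≋₂ const₂ (const c)
lift-const c zero    zero    = refl
lift-const c zero    (suc j) = refl
lift-const c (suc i) zero    = refl
lift-const c (suc i) (suc j) = refl

lift-X : lift X ≋₂ T
lift-X zero          zero    = refl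
lift-X zero          (suc j) = refl
lift-X (suc zero)    zero    = refl
lift-X (suc zero)    (suc j) = refl
lift-X (suc (suc i)) zero    = refl
lift-X (suc (suc i)) (suc j) = refl

Y-minus-lift-annihilator : ∀ f F → f 0 ≡ 0ℤ → (∀ i j → ((Y ⊞₂ ⊟₂ lift f) ⊠₂ F) i (suc j) ≡ 0ℤ) →
                           ∀ i j → F i j ≡ 0ℤ
Y-minus-lift-annihilator f F f₀≡0 vanishes = <-rec (λ i → ∀ j → F i j ≡ 0ℤ) step
  where
  coefficient : ∀ i j → ((Y ⊞₂ ⊟₂ lift f) ⊠₂ F) i (suc j) ≡ F i j ℤ.+ - sum≤ (λ a → f a ℤ.* F (i ∸ a) (suc j)) i
  coefficient i j = ≡.trans
    (solve₂ 3 (λ y l x → (y :-₂ l) :*₂ x :=₂ y :*₂ x :-₂ l :*₂ x) (λ _ _ → refl) Y (lift f) F i (suc j))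
    (≡.cong₂ (λ u v → u ℤ.+ - v) (≡.trans (const₂-⊠ X F i (suc j)) (X-⊠-suc (F i) j)) (lift-⊠₂-coeff f F i (suc j)))
  step : ∀ i → (∀ {i′} → i′ < i → ∀ j → F i′ j ≡ 0ℤ) → ∀ j → F i j ≡ 0ℤ
  step i ih j = begin
    F i j                           ≡⟨ ℤP.+-identityʳ (F i j) ⟨
    F i j ℤ.+ 0ℤ                    ≡⟨ ≡.cong (λ v → F i j ℤ.+ - v) earlier-terms ⟨
    F i j ℤ.+ - sum≤ (λ a → f a ℤ.* F (i ∸ a) (suc j)) i  ≡⟨ coefficient i j ⟨
    ((Y ⊞₂ ⊟₂ lift f) ⊠₂ F) i (suc j)                     ≡⟨ vanishes i j ⟩
    0ℤ                              ∎
    where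
    open ≡.≡-Reasoning
    earlier-terms : sum≤ (λ a → f a ℤ.* F (i ∸ a) (suc j)) i ≡ 0ℤ
    earlier-terms = Univariate.sum≤-zero _ i λ where
      zero    _      → ≡.cong (ℤ._* F i (suc j)) f₀≡0
      (suc a) 1+a≤i → ≡.trans (≡.cong (f (suc a) ℤ.*_) (ih (ℕP.∸-monoʳ-< (s≤s z≤n) 1+a≤i) (suc j))) (ℤP.*-zeroʳ (f (suc a)))

c₂ : ℤ → Series₂
c₂ c = const₂ (const c)

Lz : Series₂
Lz = 1₂ ⊞₂ lift Qz ⊞₂ ⊟₂ (T ⊠₂ (1₂ ⊞₂ Y ⊞₂ Y))

lift-Qz : lift Qz ≋₂ 1₂ ⊞₂ ⊟₂ T ⊞₂ ⊟₂ (c₂ (+ 2) ⊠₂ (T ⊠₂ lift z))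
lift-Qz = begin
  lift (1ₛ ⊞ ⊟ X ⊞ ⊟ (const (+ 2) ⊠ (X ⊠ z)))
    ≈⟨ BivariateRing.trans (lift-⊞ _ _) (BivariateRing.+-cong (lift-⊞ _ _) (lift-⊟ _)) ⟩
  lift 1ₛ ⊞₂ lift (⊟ X) ⊞₂ ⊟₂ lift (const (+ 2) ⊠ (X ⊠ z))
    ≈⟨ BivariateRing.+-cong (BivariateRing.+-cong (lift-const 1ℤ) (BivariateRing.trans (lift-⊟ X) (BivariateRing.-‿cong lift-X)))
         (BivariateRing.-‿cong (BivariateRing.trans (lift-⊠ _ _)
           (BivariateRing.*-cong (lift-const (+ 2)) (BivariateRing.trans (lift-⊠ X z) (BivariateRing.*-congʳ {lift z} lift-X))))) ⟩
  1₂ ⊞₂ ⊟₂ T ⊞₂ ⊟₂ (c₂ (+ 2) ⊠₂ (T ⊠₂ lift z)) ∎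
  where open BivariateReasoning

lift-z-unfold : lift z ⊞₂ ⊟₂ (T ⊠₂ (1₂ ⊞₂ lift z ⊞₂ lift z ⊠₂ lift z)) ≋₂ c₂ 0ℤ
lift-z-unfold = begin
  lift z ⊞₂ ⊟₂ (T ⊠₂ (1₂ ⊞₂ lift z ⊞₂ lift z ⊠₂ lift z))
    ≈⟨ BivariateRing.+-congˡ {lift z} (BivariateRing.-‿cong (BivariateRing.*-cong lift-X
         (BivariateRing.+-cong (BivariateRing.+-congʳ {lift z} (lift-const 1ℤ)) (lift-⊠ z z)))) ⟨
  lift z ⊞₂ ⊟₂ (lift X ⊠₂ (lift 1ₛ ⊞₂ lift z ⊞₂ lift (z ⊠ z)))
    ≈⟨ BivariateRing.+-congˡ {lift z} (BivariateRing.-‿cong (BivariateRing.trans (lift-⊠ X _) (BivariateRing.*-congˡ {lift X}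
         (BivariateRing.trans (lift-⊞ (1ₛ ⊞ z) (z ⊠ z)) (BivariateRing.+-congʳ {lift (z ⊠ z)} (lift-⊞ 1ₛ z)))))) ⟨
  lift z ⊞₂ ⊟₂ lift (motzkinStep z)
    ≈⟨ BivariateRing.trans (lift-⊞ z (⊟ motzkinStep z)) (BivariateRing.+-congˡ {lift z} (lift-⊟ _)) ⟨
  lift (z ⊞ ⊟ motzkinStep z)
    ≈⟨ BivariateRing.trans (lift-cong z-root) (lift-const 0ℤ) ⟩
  c₂ 0ℤ ∎
  where open BivariateReasoning

Lz-factor : Lz ⊠₂ (Y ⊞₂ ⊟₂ lift z) ≋₂ c₂ (+ 2) ⊠₂ kernel
Lz-factor = begin
  Lz ⊠₂ (Y ⊞₂ ⊟₂ lift z)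
    ≈⟨ BivariateRing.*-congʳ {Y ⊞₂ ⊟₂ lift z} (BivariateRing.+-congʳ (BivariateRing.+-congˡ {1₂} lift-Qz)) ⟩
  expanded
    ≈⟨ BivariateRing.+-identityʳ expanded ⟨
  expanded ⊞₂ c₂ 0ℤ
    ≈⟨ BivariateRing.+-congˡ {expanded}
         (BivariateRing.trans (BivariateRing.*-congˡ {c₂ (+ 2)} lift-z-unfold) (BivariateRing.zeroʳ (c₂ (+ 2)))) ⟨
  expanded ⊞₂ c₂ (+ 2) ⊠₂ (lift z ⊞₂ ⊟₂ (T ⊠₂ (1₂ ⊞₂ lift z ⊞₂ lift z ⊠₂ lift z)))
    ≈⟨ solve₂ 3 (λ t y w → (con₂ 1ℤ :+₂ (con₂ 1ℤ :-₂ t :-₂ con₂ (+ 2) :*₂ (t :*₂ w)) :-₂ t :*₂ (con₂ 1ℤ :+₂ y :+₂ y)) :*₂ (y :-₂ w)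
                            :+₂ con₂ (+ 2) :*₂ (w :-₂ t :*₂ (con₂ 1ℤ :+₂ w :+₂ w :*₂ w))
                          :=₂ con₂ (+ 2) :*₂ (y :-₂ t :*₂ (con₂ 1ℤ :+₂ y :+₂ y :*₂ y)))
                 (λ _ _ → refl) T Y (lift z) ⟩
  c₂ (+ 2) ⊠₂ kernel ∎
  where
  open BivariateReasoning
  expanded : Series₂
  expanded = (1₂ ⊞₂ (1₂ ⊞₂ ⊟₂ T ⊞₂ ⊟₂ (c₂ (+ 2) ⊠₂ (T ⊠₂ lift z))) ⊞₂ ⊟₂ (T ⊠₂ (1₂ ⊞₂ Y ⊞₂ Y))) ⊠₂ (Y ⊞₂ ⊟₂ lift z)

-- By the kernel equation, (y − z)(G · Lz − 2) = 2(z − t G(t,0)) has no positive powers of y.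
G⊠Lz : G ⊠₂ Lz ≋₂ c₂ (+ 2)
G⊠Lz i j = ℤP.i-j≡0⇒i≡j _ _ (Y-minus-lift-annihilator z (G ⊠₂ Lz ⊞₂ ⊟₂ c₂ (+ 2)) z-zero lifted i j)
  where
  open BivariateReasoning
  w G₀ : Series₂
  w  = lift z
  G₀ = lift (column₀ G)
  product-is-lift : (Y ⊞₂ ⊟₂ w) ⊠₂ (G ⊠₂ Lz ⊞₂ ⊟₂ c₂ (+ 2)) ≋₂ lift (const (+ 2) ⊠ (z ⊞ ⊟ (X ⊠ column₀ G)))
  product-is-lift = begin
    (Y ⊞₂ ⊟₂ w) ⊠₂ (G ⊠₂ Lz ⊞₂ ⊟₂ c₂ (+ 2))
      ≈⟨ solve₂ 4 (λ y w g l → (y :-₂ w) :*₂ (g :*₂ l :-₂ con₂ (+ 2)) :=₂ g :*₂ (l :*₂ (y :-₂ w)) :-₂ con₂ (+ 2) :*₂ (y :-₂ w))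
                  (λ _ _ → refl) Y w G Lz ⟩
    G ⊠₂ (Lz ⊠₂ (Y ⊞₂ ⊟₂ w)) ⊞₂ ⊟₂ (c₂ (+ 2) ⊠₂ (Y ⊞₂ ⊟₂ w))
      ≈⟨ BivariateRing.+-congʳ (BivariateRing.*-congˡ {G} Lz-factor) ⟩
    G ⊠₂ (c₂ (+ 2) ⊠₂ kernel) ⊞₂ ⊟₂ (c₂ (+ 2) ⊠₂ (Y ⊞₂ ⊟₂ w))
      ≈⟨ solve₂ 4 (λ g k y w → g :*₂ (con₂ (+ 2) :*₂ k) :-₂ con₂ (+ 2) :*₂ (y :-₂ w)
                            :=₂ con₂ (+ 2) :*₂ (g :*₂ k) :-₂ con₂ (+ 2) :*₂ (y :-₂ w))
                  (λ _ _ → refl) G kernel Y w ⟩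
    c₂ (+ 2) ⊠₂ (G ⊠₂ kernel) ⊞₂ ⊟₂ (c₂ (+ 2) ⊠₂ (Y ⊞₂ ⊟₂ w))
      ≈⟨ BivariateRing.+-congʳ (BivariateRing.*-congˡ {c₂ (+ 2)} kernel-equation) ⟩
    c₂ (+ 2) ⊠₂ (Y ⊞₂ ⊟₂ (T ⊠₂ G₀)) ⊞₂ ⊟₂ (c₂ (+ 2) ⊠₂ (Y ⊞₂ ⊟₂ w))
      ≈⟨ solve₂ 4 (λ y t g w → con₂ (+ 2) :*₂ (y :-₂ t :*₂ g) :-₂ con₂ (+ 2) :*₂ (y :-₂ w)
                            :=₂ con₂ (+ 2) :*₂ (w :-₂ t :*₂ g))
                  (λ _ _ → refl) Y T G₀ w ⟩
    c₂ (+ 2) ⊠₂ (w ⊞₂ ⊟₂ (T ⊠₂ G₀))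
      ≈⟨ BivariateRing.*-cong (lift-const (+ 2)) (BivariateRing.+-congˡ {w} (BivariateRing.-‿cong
           (BivariateRing.trans (lift-⊠ X (column₀ G)) (BivariateRing.*-congʳ {G₀} lift-X)))) ⟨
    lift (const (+ 2)) ⊠₂ (w ⊞₂ ⊟₂ lift (X ⊠ column₀ G))
      ≈⟨ BivariateRing.trans (lift-⊠ _ _) (BivariateRing.*-congˡ {lift (const (+ 2))}
           (BivariateRing.trans (lift-⊞ _ _) (BivariateRing.+-congˡ {w} (lift-⊟ _)))) ⟨
    lift (const (+ 2) ⊠ (z ⊞ ⊟ (X ⊠ column₀ G))) ∎
  lifted : ∀ i j → ((Y ⊞₂ ⊟₂ w) ⊠₂ (G ⊠₂ Lz ⊞₂ ⊟₂ c₂ (+ 2))) i (suc j) ≡ 0ℤ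
  lifted i j = product-is-lift i (suc j)

-- Even and odd parts in t: the first two identities

⊞₂-halve : ∀ F H → F ⊞₂ F ≋₂ H ⊞₂ H → F ≋₂ H
⊞₂-halve F H 2F≋2H i j = ℤP.*-cancelˡ-≡ (+ 2) (F i j) (H i j)
  (≡.trans (double (F i j)) (≡.trans (2F≋2H i j) (≡.sym (double (H i j)))))
  where
  double : ∀ x → + 2 ℤ.* x ≡ x ℤ.+ x
  double = solve-∀

module EvenOddParts (G G⁻ L R : Series₂) (GL≋2 : G ⊠₂ L ≋₂ c₂ (+ 2)) (G⁻R≋2 : G⁻ ⊠₂ R ≋₂ c₂ (+ 2)) where
  open BivariateReasoning

  even-part-product : ∀ A → A ⊞₂ A ≋₂ G ⊞₂ G⁻ → A ⊠₂ L ⊠₂ R ≋₂ L ⊞₂ R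
  even-part-product A 2A≋ = ⊞₂-halve _ _ (begin
    A ⊠₂ L ⊠₂ R ⊞₂ A ⊠₂ L ⊠₂ R
      ≈⟨ solve₂ 3 (λ e l r → e :*₂ l :*₂ r :+₂ e :*₂ l :*₂ r :=₂ (e :+₂ e) :*₂ l :*₂ r) (λ _ _ → refl) A L R ⟩
    (A ⊞₂ A) ⊠₂ L ⊠₂ R
      ≈⟨ BivariateRing.*-congʳ {R} (BivariateRing.*-congʳ {L} 2A≋) ⟩
    (G ⊞₂ G⁻) ⊠₂ L ⊠₂ R
      ≈⟨ solve₂ 4 (λ g h l r → (g :+₂ h) :*₂ l :*₂ r :=₂ g :*₂ l :*₂ r :+₂ h :*₂ r :*₂ l) (λ _ _ → refl) G G⁻ L R ⟩
    G ⊠₂ L ⊠₂ R ⊞₂ G⁻ ⊠₂ R ⊠₂ L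
      ≈⟨ BivariateRing.+-cong (BivariateRing.*-congʳ {R} GL≋2) (BivariateRing.*-congʳ {L} G⁻R≋2) ⟩
    c₂ (+ 2) ⊠₂ R ⊞₂ c₂ (+ 2) ⊠₂ L
      ≈⟨ solve₂ 2 (λ l r → con₂ (+ 2) :*₂ r :+₂ con₂ (+ 2) :*₂ l :=₂ (l :+₂ r) :+₂ (l :+₂ r)) (λ _ _ → refl) L R ⟩
    (L ⊞₂ R) ⊞₂ (L ⊞₂ R) ∎)

  odd-part-product : ∀ O → O ⊞₂ O ≋₂ G ⊞₂ ⊟₂ G⁻ → O ⊠₂ L ⊠₂ R ≋₂ R ⊞₂ ⊟₂ L
  odd-part-product O 2O≋ = ⊞₂-halve _ _ (begin
    O ⊠₂ L ⊠₂ R ⊞₂ O ⊠₂ L ⊠₂ R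
      ≈⟨ solve₂ 3 (λ e l r → e :*₂ l :*₂ r :+₂ e :*₂ l :*₂ r :=₂ (e :+₂ e) :*₂ l :*₂ r) (λ _ _ → refl) O L R ⟩
    (O ⊞₂ O) ⊠₂ L ⊠₂ R
      ≈⟨ BivariateRing.*-congʳ {R} (BivariateRing.*-congʳ {L} 2O≋) ⟩
    (G ⊞₂ ⊟₂ G⁻) ⊠₂ L ⊠₂ R
      ≈⟨ solve₂ 4 (λ g h l r → (g :-₂ h) :*₂ l :*₂ r :=₂ g :*₂ l :*₂ r :-₂ h :*₂ r :*₂ l) (λ _ _ → refl) G G⁻ L R ⟩
    G ⊠₂ L ⊠₂ R ⊞₂ ⊟₂ (G⁻ ⊠₂ R ⊠₂ L)
      ≈⟨ BivariateRing.+-cong (BivariateRing.*-congʳ {R} GL≋2) (BivariateRing.-‿cong (BivariateRing.*-congʳ {L} G⁻R≋2)) ⟩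
    c₂ (+ 2) ⊠₂ R ⊞₂ ⊟₂ (c₂ (+ 2) ⊠₂ L)
      ≈⟨ solve₂ 2 (λ l r → con₂ (+ 2) :*₂ r :-₂ con₂ (+ 2) :*₂ l :=₂ (r :-₂ l) :+₂ (r :-₂ l)) (λ _ _ → refl) L R ⟩
    (R ⊞₂ ⊟₂ L) ⊞₂ (R ⊞₂ ⊟₂ L) ∎)

leftFactor rightFactor : Series → Series₂
leftFactor  Q = lift (poly (1ℤ ∷ []) ⊕ Q) ⊖₂ tY
rightFactor R = lift (poly (1ℤ ∷ []) ⊕ R) ⊕₂ tY

tY≋₂ : tY ≋₂ T ⊠₂ (1₂ ⊞₂ Y ⊞₂ Y)
tY≋₂ zero          zero          = ≡.sym (T-⊠-zero (1₂ ⊞₂ Y ⊞₂ Y) 0)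
tY≋₂ zero          (suc j)       = ≡.sym (T-⊠-zero (1₂ ⊞₂ Y ⊞₂ Y) (suc j))
tY≋₂ (suc zero)    zero          = ≡.sym (T-⊠-suc (1₂ ⊞₂ Y ⊞₂ Y) 0 0)
tY≋₂ (suc zero)    (suc zero)    = ≡.sym (T-⊠-suc (1₂ ⊞₂ Y ⊞₂ Y) 0 1)
tY≋₂ (suc zero)    (suc (suc j)) = ≡.sym (T-⊠-suc (1₂ ⊞₂ Y ⊞₂ Y) 0 (suc (suc j)))
tY≋₂ (suc (suc i)) zero          = ≡.sym (T-⊠-suc (1₂ ⊞₂ Y ⊞₂ Y) (suc i) 0)
tY≋₂ (suc (suc i)) (suc j)       = ≡.sym (T-⊠-suc (1₂ ⊞₂ Y ⊞₂ Y) (suc i) (suc j))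

leftFactor≋Lz : ∀ Q → Q ≋ Qz → leftFactor Q ≋₂ Lz
leftFactor≋Lz Q Q≋Qz i j = ≡.cong₂ (λ u v → u ℤ.+ - v) (constant-part i j) (tY≋₂ i j)
  where
  constant-part : ∀ i j → lift (poly (1ℤ ∷ []) ⊕ Q) i j ≡ (1₂ ⊞₂ lift Qz) i j
  constant-part zero    zero    = ≡.cong (ℤ._+_ 1ℤ) (Q≋Qz 0)
  constant-part (suc i) zero    = ≡.cong (ℤ._+_ 0ℤ) (Q≋Qz (suc i))
  constant-part zero    (suc j) = refl
  constant-part (suc i) (suc j) = refl

neg^₂-coeff : ∀ i f j → Bivariate.neg^ i f j ≡ neg^ i (f j)
neg^₂-coeff zero    f j = refl
neg^₂-coeff (suc i) f j = ≡.cong -_ (neg^₂-coeff i f j)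

negateX-leftFactor : ∀ Q R → R ≋ negateX Q → Bivariate.negateX (leftFactor Q) ≋₂ rightFactor R
negateX-leftFactor Q R R≋ i j = ≡.trans (neg^₂-coeff i (leftFactor Q i) j)
  (≡.trans (Univariate.neg^-+ i _ _) (≡.cong₂ ℤ._+_ (constant-part i j) (≡.trans (Univariate.neg^-neg i _) (tY-part i j))))
  where
  constant-part : ∀ i j → neg^ i (lift (poly (1ℤ ∷ []) ⊕ Q) i j) ≡ lift (poly (1ℤ ∷ []) ⊕ R) i j
  constant-part zero    zero    = ≡.cong (ℤ._+_ 1ℤ) (≡.sym (R≋ 0))
  constant-part (suc i) zero    = ≡.trans (Univariate.neg^-+ (suc i) _ _)
    (≡.cong₂ ℤ._+_ (Univariate.neg^-0# (suc i)) (≡.sym (R≋ (suc i))))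
  constant-part i       (suc j) = Univariate.neg^-0# i
  tY-part : ∀ i j → - neg^ i (tY i j) ≡ tY i j
  tY-part zero          j             = refl
  tY-part (suc zero)    zero          = refl
  tY-part (suc zero)    (suc zero)    = refl
  tY-part (suc zero)    (suc (suc j)) = refl
  tY-part (suc (suc i)) zero          = ≡.cong -_ (Univariate.neg^-0# (suc (suc i)))
  tY-part (suc (suc i)) (suc j)       = ≡.cong -_ (Univariate.neg^-0# (suc (suc i)))

negateX-c₂ : ∀ c → Bivariate.negateX (c₂ c) ≋₂ c₂ c
negateX-c₂ c zero    j = refl
negateX-c₂ c (suc i) j = ≡.trans (neg^₂-coeff (suc i) (c₂ c (suc i)) j) (zero-coeff j)
  where
  zero-coeff : ∀ j → neg^ (suc i) (const 0ℤ j) ≡ const 0ℤ j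
  zero-coeff zero    = Univariate.neg^-0# (suc i)
  zero-coeff (suc j) = Univariate.neg^-0# (suc i)

leftFactor⊞rightFactor : ∀ Q R → leftFactor Q ⊞₂ rightFactor R ≋₂ lift (R ⊕ Q ⊕ poly (+ 2 ∷ []))
leftFactor⊞rightFactor Q R zero    zero    = rearrange (Q 0) (R 0) (tY 0 0)
  where
  rearrange : ∀ q r t → (1ℤ ℤ.+ q ℤ.+ - t) ℤ.+ (1ℤ ℤ.+ r ℤ.+ t) ≡ r ℤ.+ q ℤ.+ + 2
  rearrange = solve-∀
leftFactor⊞rightFactor Q R (suc i) zero    = rearrange (Q (suc i)) (R (suc i)) (tY (suc i) 0)
  where
  rearrange : ∀ q r t → (0ℤ ℤ.+ q ℤ.+ - t) ℤ.+ (0ℤ ℤ.+ r ℤ.+ t) ≡ r ℤ.+ q ℤ.+ 0ℤ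
  rearrange = solve-∀
leftFactor⊞rightFactor Q R i       (suc j) = cancel (tY i (suc j))
  where
  cancel : ∀ t → (0ℤ ℤ.+ - t) ℤ.+ (0ℤ ℤ.+ t) ≡ 0ℤ
  cancel = solve-∀

rightFactor⊟leftFactor : ∀ Q R → rightFactor R ⊞₂ ⊟₂ leftFactor Q ≋₂ lift (R ⊖ Q) ⊕₂ tY ⊕₂ tY
rightFactor⊟leftFactor Q R i zero    = rearrange (Q i) (R i) (poly (1ℤ ∷ []) i) (tY i 0)
  where
  rearrange : ∀ q r p t → (p ℤ.+ r ℤ.+ t) ℤ.+ - (p ℤ.+ q ℤ.+ - t) ≡ r ℤ.+ - q ℤ.+ t ℤ.+ t
  rearrange = solve-∀
rightFactor⊟leftFactor Q R i (suc j) = rearrange (tY i (suc j))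
  where
  rearrange : ∀ t → (0ℤ ℤ.+ t) ℤ.+ - (0ℤ ℤ.+ - t) ≡ 0ℤ ℤ.+ t ℤ.+ t
  rearrange = solve-∀

data Parity : ℕ → Set where
  even : ∀ n → Parity (twice n)
  odd  : ∀ n → Parity (suc (twice n))

parity : ∀ i → Parity i
parity zero          = even 0
parity (suc zero)    = odd 0
parity (suc (suc i)) with parity i
... | even n = even (suc n)
... | odd  n = odd (suc n)

neg^-twice : ∀ n x → neg^ (twice n) x ≡ x
neg^-twice zero    x = refl
neg^-twice (suc n) x = ≡.trans (ℤP.neg-involutive _) (neg^-twice n x)

substSq-twice : ∀ a n j → substSq a (twice n) j ≡ + a n j
substSq-twice a n j = ≡.trans (substSq-even (twice n) (isEven-twice n)) (≡.cong (λ k → + a k j) (half-twice n))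
  where
  isEven-twice : ∀ n → isEven (twice n) ≡ true
  isEven-twice zero    = refl
  isEven-twice (suc n) = isEven-twice n
  half-twice : ∀ n → half (twice n) ≡ n
  half-twice zero    = refl
  half-twice (suc n) = ≡.cong suc (half-twice n)
  substSq-even : ∀ i → isEven i ≡ true → substSq a i j ≡ + a (half i) j
  substSq-even i _ with isEven i
  substSq-even i refl  | true = refl

substSq-suc-twice : ∀ a n j → substSq a (suc (twice n)) j ≡ 0ℤ
substSq-suc-twice a n j = substSq-odd (suc (twice n)) (isEven-suc-twice n)
  where
  isEven-suc-twice : ∀ n → isEven (suc (twice n)) ≡ false
  isEven-suc-twice zero    = refl
  isEven-suc-twice (suc n) = isEven-suc-twice n
  substSq-odd : ∀ i → isEven i ≡ false → substSq a i j ≡ 0ℤ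
  substSq-odd i _ with isEven i
  substSq-odd i refl | false = refl

G⁻ : Series₂
G⁻ = Bivariate.negateX G

G⁻-coeff : ∀ i j → G⁻ i j ≡ neg^ i (G i j)
G⁻-coeff i j = neg^₂-coeff i (G i) j

even-part : ∀ aQR → (∀ n m → HasSize (IsAQRPath n m) (aQR n m)) → substSq aQR ⊞₂ substSq aQR ≋₂ G ⊞₂ G⁻
even-part aQR size i j with parity i
... | even n = ≡.cong₂ ℤ._+_ counted (≡.trans counted (≡.sym (≡.trans (G⁻-coeff (twice n) j) (neg^-twice n _))))
  where
  counted : substSq aQR (twice n) j ≡ G (twice n) j
  counted = ≡.trans (substSq-twice aQR n j) (≡.cong +_ (aQR≡motzkin n j _ (size n j)))
... | odd  n = ≡.trans (≡.cong₂ ℤ._+_ (substSq-suc-twice aQR n j) (substSq-suc-twice aQR n j)) (≡.sym (begin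
  G i j ℤ.+ G⁻ i j          ≡⟨ ≡.cong (ℤ._+_ (G i j)) (≡.trans (G⁻-coeff i j) (≡.cong -_ (neg^-twice n _))) ⟩
  G i j ℤ.+ - G i j         ≡⟨ ℤP.+-inverseʳ (G i j) ⟩
  0ℤ                        ∎))
  where open ≡.≡-Reasoning

odd-part : ∀ aQ → (∀ n m → HasSize (IsAQPath n m) (aQ n m)) → T ⊠₂ substSq aQ ⊞₂ T ⊠₂ substSq aQ ≋₂ G ⊞₂ ⊟₂ G⁻
odd-part aQ size zero    j = ≡.trans (≡.cong₂ ℤ._+_ (T-⊠-zero (substSq aQ) j) (T-⊠-zero (substSq aQ) j))
  (≡.trans (zero-coeff j) (≡.sym (ℤP.+-inverseʳ (G 0 j))))
  where
  zero-coeff : ∀ j → const 0ℤ j ℤ.+ const 0ℤ j ≡ 0ℤ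
  zero-coeff zero    = refl
  zero-coeff (suc j) = refl
odd-part aQ size (suc i) j with parity i
... | even n = ≡.cong₂ ℤ._+_ counted (≡.trans counted (≡.sym (≡.trans
      (≡.cong -_ (≡.trans (G⁻-coeff (suc (twice n)) j) (≡.cong -_ (neg^-twice n _)))) (ℤP.neg-involutive _))))
  where
  counted : (T ⊠₂ substSq aQ) (suc (twice n)) j ≡ G (suc (twice n)) j
  counted = ≡.trans (T-⊠-suc (substSq aQ) (twice n) j)
    (≡.trans (substSq-twice aQ n j) (≡.cong +_ (aQ≡motzkin n j _ (size n j))))
... | odd  n = ≡.trans (≡.cong₂ ℤ._+_ vanishes vanishes) (≡.sym (begin
  G (suc i) j ℤ.+ - G⁻ (suc i) j
    ≡⟨ ≡.cong (λ v → G (suc i) j ℤ.+ - v) (≡.trans (G⁻-coeff (suc i) j) (neg^-twice (suc n) _)) ⟩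
  G (suc i) j ℤ.+ - G (suc i) j    ≡⟨ ℤP.+-inverseʳ (G (suc i) j) ⟩
  0ℤ                               ∎))
  where
  open ≡.≡-Reasoning
  vanishes : (T ⊠₂ substSq aQ) (suc (suc (twice n))) j ≡ 0ℤ
  vanishes = ≡.trans (T-⊠-suc (substSq aQ) (suc (twice n)) j) (substSq-suc-twice aQ n j)

module Identities12 (Q R : Series) (Q≋Qz : Q ≋ Qz) (R≋ : R ≋ negateX Q) where
  open BivariateReasoning

  G⊠leftFactor : G ⊠₂ leftFactor Q ≋₂ c₂ (+ 2)
  G⊠leftFactor = BivariateRing.trans (BivariateRing.*-congˡ {G} (leftFactor≋Lz Q Q≋Qz)) G⊠Lz

  G⁻⊠rightFactor : G⁻ ⊠₂ rightFactor R ≋₂ c₂ (+ 2)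
  G⁻⊠rightFactor = begin
    G⁻ ⊠₂ rightFactor R                       ≈⟨ BivariateRing.*-congˡ {G⁻} (negateX-leftFactor Q R R≋) ⟨
    G⁻ ⊠₂ Bivariate.negateX (leftFactor Q)    ≈⟨ Bivariate.negateX-⊠ G (leftFactor Q) ⟨
    Bivariate.negateX (G ⊠₂ leftFactor Q)     ≈⟨ Bivariate.negateX-cong G⊠leftFactor ⟩
    Bivariate.negateX (c₂ (+ 2))              ≈⟨ negateX-c₂ (+ 2) ⟩
    c₂ (+ 2)                                  ∎

  open EvenOddParts G G⁻ (leftFactor Q) (rightFactor R) G⊠leftFactor G⁻⊠rightFactor

  ⊛₂-⊛₂≋ : ∀ A B C → A ⊛₂ B ⊛₂ C ≋₂ A ⊠₂ B ⊠₂ C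
  ⊛₂-⊛₂≋ A B C = BivariateRing.trans (⊛₂≗⊠₂ (A ⊛₂ B) C) (BivariateRing.*-congʳ {C} (⊛₂≗⊠₂ A B))

  identity₁ : ∀ aQR → (∀ n m → HasSize (IsAQRPath n m) (aQR n m)) →
              substSq aQR ⊛₂ leftFactor Q ⊛₂ rightFactor R ≈₂ lift (R ⊕ Q ⊕ poly (+ 2 ∷ []))
  identity₁ aQR size = begin
    substSq aQR ⊛₂ leftFactor Q ⊛₂ rightFactor R   ≈⟨ ⊛₂-⊛₂≋ (substSq aQR) (leftFactor Q) (rightFactor R) ⟩
    substSq aQR ⊠₂ leftFactor Q ⊠₂ rightFactor R   ≈⟨ even-part-product (substSq aQR) (even-part aQR size) ⟩
    leftFactor Q ⊞₂ rightFactor R                  ≈⟨ leftFactor⊞rightFactor Q R ⟩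
    lift (R ⊕ Q ⊕ poly (+ 2 ∷ []))                 ∎

  identity₂ : ∀ aQ → (∀ n m → HasSize (IsAQPath n m) (aQ n m)) →
              tS ⊛₂ substSq aQ ⊛₂ leftFactor Q ⊛₂ rightFactor R ≈₂ lift (R ⊖ Q) ⊕₂ tY ⊕₂ tY
  identity₂ aQ size = begin
    tS ⊛₂ substSq aQ ⊛₂ leftFactor Q ⊛₂ rightFactor R  ≈⟨ ⊛₂-⊛₂≋ (tS ⊛₂ substSq aQ) (leftFactor Q) (rightFactor R) ⟩
    (tS ⊛₂ substSq aQ) ⊠₂ leftFactor Q ⊠₂ rightFactor R
      ≈⟨ BivariateRing.*-congʳ {rightFactor R} (BivariateRing.*-congʳ {leftFactor Q}
           (BivariateRing.trans (⊛₂≗⊠₂ tS (substSq aQ)) (BivariateRing.*-congʳ {substSq aQ} tS≋T))) ⟩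
    (T ⊠₂ substSq aQ) ⊠₂ leftFactor Q ⊠₂ rightFactor R  ≈⟨ odd-part-product (T ⊠₂ substSq aQ) (odd-part aQ size) ⟩
    rightFactor R ⊞₂ ⊟₂ leftFactor Q                    ≈⟨ rightFactor⊟leftFactor Q R ⟩
    lift (R ⊖ Q) ⊕₂ tY ⊕₂ tY                            ∎
    where
    tS≋T : tS ≋₂ T
    tS≋T zero          zero          = refl
    tS≋T zero          (suc j)       = refl
    tS≋T (suc zero)    zero          = refl
    tS≋T (suc zero)    (suc zero)    = refl
    tS≋T (suc zero)    (suc (suc j)) = refl
    tS≋T (suc (suc i)) zero          = refl
    tS≋T (suc (suc i)) (suc j)       = refl

-- The substitution x = t² and the y-free parts: the last two identities

substSq₁ : Series → Series
substSq₁ f zero          = f 0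
substSq₁ f (suc zero)    = 0ℤ
substSq₁ f (suc (suc k)) = substSq₁ (tail f) k

substSq₁-twice : ∀ f n → substSq₁ f (twice n) ≡ f n
substSq₁-twice f zero    = refl
substSq₁-twice f (suc n) = substSq₁-twice (tail f) n

substSq₁-suc-twice : ∀ f n → substSq₁ f (suc (twice n)) ≡ 0ℤ
substSq₁-suc-twice f zero    = refl
substSq₁-suc-twice f (suc n) = substSq₁-suc-twice (tail f) n

substSq₁-injective : ∀ f g → substSq₁ f ≋ substSq₁ g → f ≋ g
substSq₁-injective f g eq n = ≡.trans (≡.sym (substSq₁-twice f n)) (≡.trans (eq (twice n)) (substSq₁-twice g n))

substSq₁-cong : ∀ {f g} → f ≋ g → substSq₁ f ≋ substSq₁ g
substSq₁-cong f≋g zero          = f≋g 0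
substSq₁-cong f≋g (suc zero)    = refl
substSq₁-cong f≋g (suc (suc k)) = substSq₁-cong (λ i → f≋g (suc i)) k

substSq₁-⊞ : ∀ f g → substSq₁ (f ⊞ g) ≋ substSq₁ f ⊞ substSq₁ g
substSq₁-⊞ f g zero          = refl
substSq₁-⊞ f g (suc zero)    = refl
substSq₁-⊞ f g (suc (suc k)) = substSq₁-⊞ (tail f) (tail g) k

substSq₁-⊟ : ∀ f → substSq₁ (⊟ f) ≋ ⊟ substSq₁ f
substSq₁-⊟ f zero          = refl
substSq₁-⊟ f (suc zero)    = refl
substSq₁-⊟ f (suc (suc k)) = substSq₁-⊟ (tail f) k

substSq₁-scale : ∀ c f → substSq₁ (scale c f) ≋ scale c (substSq₁ f)
substSq₁-scale c f zero          = refl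
substSq₁-scale c f (suc zero)    = ≡.sym (ℤP.*-zeroʳ c)
substSq₁-scale c f (suc (suc k)) = substSq₁-scale c (tail f) k

substSq₁-vanish : ∀ f → (∀ k → f k ≡ 0ℤ) → ∀ k → substSq₁ f k ≡ 0ℤ
substSq₁-vanish f f≡0 zero          = f≡0 0
substSq₁-vanish f f≡0 (suc zero)    = refl
substSq₁-vanish f f≡0 (suc (suc k)) = substSq₁-vanish (tail f) (λ i → f≡0 (suc i)) k

substSq₁-const : ∀ c → substSq₁ (const c) ≋ const c
substSq₁-const c zero          = refl
substSq₁-const c (suc zero)    = refl
substSq₁-const c (suc (suc k)) = substSq₁-vanish (tail (const c)) (λ _ → refl) k

substSq₁-X : substSq₁ X ≋ X ⊠ X
substSq₁-X zero          = refl
substSq₁-X (suc zero)    = refl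
substSq₁-X (suc (suc k)) = ≡.trans (shifted k) (≡.sym (X-⊠-suc X (suc k)))
  where
  shifted : ∀ k → substSq₁ (tail X) k ≡ X (suc k)
  shifted zero          = refl
  shifted (suc zero)    = refl
  shifted (suc (suc k)) = substSq₁-vanish (tail (tail X)) (λ _ → refl) k

substSq₁-⊠ : ∀ f g → substSq₁ (f ⊠ g) ≋ substSq₁ f ⊠ substSq₁ g
substSq₁-⊠ f g zero          = refl
substSq₁-⊠ f g (suc zero)    = vanish (f 0) (g 0)
  where
  vanish : ∀ a b → 0ℤ ≡ a ℤ.* 0ℤ ℤ.+ 0ℤ ℤ.* b
  vanish = solve-∀
substSq₁-⊠ f g (suc (suc k)) = begin
  substSq₁ (tail (f ⊠ g)) k
    ≡⟨ substSq₁-cong (Univariate.⊠-suc f g) k ⟩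
  substSq₁ (scale (f 0) (tail g) ⊞ tail f ⊠ g) k
    ≡⟨ substSq₁-⊞ (scale (f 0) (tail g)) (tail f ⊠ g) k ⟩
  substSq₁ (scale (f 0) (tail g)) k ℤ.+ substSq₁ (tail f ⊠ g) k
    ≡⟨ ≡.cong₂ ℤ._+_ (substSq₁-scale (f 0) (tail g) k) (substSq₁-⊠ (tail f) g k) ⟩
  f 0 ℤ.* substSq₁ (tail g) k ℤ.+ (substSq₁ (tail f) ⊠ substSq₁ g) k
    ≡⟨ ≡.cong (ℤ._+_ (f 0 ℤ.* substSq₁ (tail g) k)) (≡.trans (≡.sym (ℤP.+-identityˡ _))
         (≡.trans (≡.cong (ℤ._+ (substSq₁ (tail f) ⊠ substSq₁ g) k) (≡.sym (ℤP.*-zeroˡ (substSq₁ g (suc k)))))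
           (≡.sym (Univariate.⊠-suc (tail (substSq₁ f)) (substSq₁ g) k)))) ⟩
  f 0 ℤ.* substSq₁ (tail g) k ℤ.+ (tail (substSq₁ f) ⊠ substSq₁ g) (suc k)
    ≡⟨ Univariate.⊠-suc (substSq₁ f) (substSq₁ g) (suc k) ⟨
  (substSq₁ f ⊠ substSq₁ g) (suc (suc k)) ∎
  where open ≡.≡-Reasoning

hornerSq : List ℤ → Series
hornerSq []       = const 0ℤ
hornerSq (c ∷ cs) = const c ⊞ X ⊠ X ⊠ hornerSq cs

substSq₁-horner : ∀ cs → substSq₁ (horner cs) ≋ hornerSq cs
substSq₁-horner []       = substSq₁-const 0ℤ
substSq₁-horner (c ∷ cs) = SeriesRing.trans (substSq₁-⊞ (const c) (X ⊠ horner cs))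
  (SeriesRing.+-cong (substSq₁-const c)
    (SeriesRing.trans (substSq₁-⊠ X (horner cs)) (SeriesRing.*-cong substSq₁-X (substSq₁-horner cs))))

column₀-⊠ : ∀ F H → column₀ (F ⊠₂ H) ≋ column₀ F ⊠ column₀ H
column₀-⊠ F H i = ≡.trans (≡.sym (⊛₂≗⊠₂ F H i 0)) (sumTo≡sum≤ _ i)

column₀-c₂ : ∀ c → column₀ (c₂ c) ≋ const c
column₀-c₂ c zero    = refl
column₀-c₂ c (suc i) = refl

column₀-T : column₀ T ≋ X
column₀-T zero          = refl
column₀-T (suc zero)    = refl
column₀-T (suc (suc i)) = refl

column₀-substSq : ∀ a → column₀ (substSq a) ≋ substSq₁ (diag0 a)
column₀-substSq a i with parity i
... | even n = ≡.trans (substSq-twice a n 0) (≡.sym (substSq₁-twice (diag0 a) n))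
... | odd  n = ≡.trans (substSq-suc-twice a n 0) (≡.sym (substSq₁-suc-twice (diag0 a) n))

M : Series
M = column₀ G

column₀-G⁻ : column₀ G⁻ ≋ negateX M
column₀-G⁻ i = G⁻-coeff i 0

Cz : Series
Cz = 1ₛ ⊞ Qz ⊞ ⊟ X

column₀-Lz : column₀ Lz ≋ Cz
column₀-Lz i = ≡.cong₂ (λ u v → u ℤ.+ Qz i ℤ.+ - v) (one i) (≡.trans (≡.sym (tY≋₂ i 0)) (tY-column i))
  where
  one : ∀ i → 1₂ i 0 ≡ 1ₛ i
  one zero    = refl
  one (suc i) = refl
  tY-column : ∀ i → tY i 0 ≡ X i
  tY-column zero          = refl
  tY-column (suc zero)    = refl
  tY-column (suc (suc i)) = refl

M⊠Cz : M ⊠ Cz ≋ const (+ 2)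
M⊠Cz i = begin
  (M ⊠ Cz) i                 ≡⟨ SeriesRing.*-congˡ {M} (λ k → ≡.sym (column₀-Lz k)) i ⟩
  (M ⊠ column₀ Lz) i         ≡⟨ column₀-⊠ G Lz i ⟨
  column₀ (G ⊠₂ Lz) i        ≡⟨ G⊠Lz i 0 ⟩
  column₀ (c₂ (+ 2)) i       ≡⟨ column₀-c₂ (+ 2) i ⟩
  const (+ 2) i              ∎
  where open ≡.≡-Reasoning

X⊠M≋z : X ⊠ M ≋ z
X⊠M≋z = ⊠-cancelʳ (X ⊠ M) z Cz (λ ()) (begin
  X ⊠ M ⊠ Cz                                       ≈⟨ SeriesRing.*-assoc X M Cz ⟩
  X ⊠ (M ⊠ Cz)                                     ≈⟨ SeriesRing.*-congˡ {X} M⊠Cz ⟩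
  X ⊠ const (+ 2)                                  ≈⟨ SeriesRing.+-identityʳ _ ⟨
  X ⊠ const (+ 2) ⊞ const 0ℤ                       ≈⟨ SeriesRing.+-congˡ {X ⊠ const (+ 2)} z-term ⟨
  X ⊠ const (+ 2) ⊞ const (+ 2) ⊠ (z ⊞ ⊟ motzkinStep z)
    ≈⟨ solve 2 (λ x z → x :* con (+ 2) :+ con (+ 2) :* (z :- x :* (con 1ℤ :+ z :+ z :* z))
                    := z :* (con 1ℤ :+ (con 1ℤ :- x :- con (+ 2) :* (x :* z)) :- x)) (λ _ → refl) X z ⟩
  z ⊠ Cz                                           ∎)
  where
  open SeriesReasoning
  z-term : const (+ 2) ⊠ (z ⊞ ⊟ motzkinStep z) ≋ const 0ℤ
  z-term = SeriesRing.trans (SeriesRing.*-congˡ {const (+ 2)} z-root) (SeriesRing.zeroʳ (const (+ 2)))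

⊠-cancelˡ : ∀ h f g → h 0 ≢ 0ℤ → h ⊠ f ≋ h ⊠ g → f ≋ g
⊠-cancelˡ h f g h₀≢0 hf≋hg = ⊠-cancelʳ f g h h₀≢0 (λ k → ≡.trans (⊠-comm f h k) (≡.trans (hf≋hg k) (⊠-comm h g k)))

X-⊠-cancel : ∀ f g → X ⊠ f ≋ X ⊠ g → f ≋ g
X-⊠-cancel f g Xf≋Xg k = ≡.trans (≡.sym (X-⊠-suc f k)) (≡.trans (Xf≋Xg (suc k)) (X-⊠-suc g k))

substSq₁-poly : ∀ cs → substSq₁ (poly cs) ≋ hornerSq cs
substSq₁-poly cs = SeriesRing.trans (substSq₁-cong (poly≋horner cs)) (substSq₁-horner cs)

poly-constant : ∀ c → poly (c ∷ []) ≋ const c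
poly-constant c zero    = refl
poly-constant c (suc k) = refl

poly-2X : poly (0ℤ ∷ + 2 ∷ []) ≋ const (+ 2) ⊠ X
poly-2X k = SeriesRing.trans (poly≋horner (0ℤ ∷ + 2 ∷ []))
  (solve 1 (λ x → con 0ℤ :+ x :* (con (+ 2) :+ x :* con 0ℤ) := con (+ 2) :* x) (λ _ → refl) X) k

negateX-const : ∀ c → negateX (const c) ≋ const c
negateX-const c zero    = refl
negateX-const c (suc k) = Univariate.neg^-0# (suc k)

negateX-X : negateX X ≋ ⊟ X
negateX-X zero          = refl
negateX-X (suc zero)    = refl
negateX-X (suc (suc k)) = Univariate.neg^-0# (suc (suc k))

even-part-column₀ : ∀ aQR → (∀ n m → HasSize (IsAQRPath n m) (aQR n m)) →
                    substSq₁ (diag0 aQR) ⊞ substSq₁ (diag0 aQR) ≋ M ⊞ negateX M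
even-part-column₀ aQR size i = ≡.trans
  (≡.cong₂ ℤ._+_ (≡.sym (column₀-substSq aQR i)) (≡.sym (column₀-substSq aQR i)))
  (≡.trans (even-part aQR size i 0) (≡.cong (ℤ._+_ (M i)) (column₀-G⁻ i)))

odd-part-column₀ : ∀ aQ → (∀ n m → HasSize (IsAQPath n m) (aQ n m)) →
                   X ⊠ substSq₁ (diag0 aQ) ⊞ X ⊠ substSq₁ (diag0 aQ) ≋ M ⊞ ⊟ negateX M
odd-part-column₀ aQ size i = ≡.trans (≡.cong₂ ℤ._+_ (≡.sym (column₀-T⊠ i)) (≡.sym (column₀-T⊠ i)))
  (≡.trans (odd-part aQ size i 0) (≡.cong (λ v → M i ℤ.+ - v) (column₀-G⁻ i)))
  where
  column₀-T⊠ : column₀ (T ⊠₂ substSq aQ) ≋ X ⊠ substSq₁ (diag0 aQ)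
  column₀-T⊠ = SeriesRing.trans (column₀-⊠ T (substSq aQ)) (SeriesRing.*-cong column₀-T (column₀-substSq aQ))

module Identities34 (Q R P : Series) (Q≋Qz : Q ≋ Qz) (R≋ : R ≋ negateX Q)
  (P₀≡1 : P 0 ≡ 1ℤ) (PP≈ : P ⊛ P ≈₁ poly (1ℤ ∷ - (+ 10) ∷ + 9 ∷ [])) where
  open SeriesReasoning

  X² : Series
  X² = X ⊠ X

  2X²M : const (+ 2) ⊠ X² ⊠ M ≋ 1ₛ ⊞ ⊟ X ⊞ ⊟ Q
  2X²M = begin
    const (+ 2) ⊠ X² ⊠ M      ≈⟨ solve 2 (λ x m → con (+ 2) :* (x :* x) :* m := con (+ 2) :* x :* (x :* m)) (λ _ → refl) X M ⟩
    const (+ 2) ⊠ X ⊠ (X ⊠ M) ≈⟨ SeriesRing.*-congˡ {const (+ 2) ⊠ X} X⊠M≋z ⟩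
    const (+ 2) ⊠ X ⊠ z       ≈⟨ solve 2 (λ x z → con (+ 2) :* x :* z := con 1ℤ :- x :- (con 1ℤ :- x :- con (+ 2) :* (x :* z)))
                                        (λ _ → refl) X z ⟩
    1ₛ ⊞ ⊟ X ⊞ ⊟ Qz           ≈⟨ SeriesRing.+-congˡ {1ₛ ⊞ ⊟ X} (SeriesRing.-‿cong Q≋Qz) ⟨
    1ₛ ⊞ ⊟ X ⊞ ⊟ Q            ∎

  2X²M⁻ : const (+ 2) ⊠ X² ⊠ negateX M ≋ 1ₛ ⊞ X ⊞ ⊟ R
  2X²M⁻ = begin
    const (+ 2) ⊠ X² ⊠ negateX M
      ≈⟨ solve 2 (λ x m → con (+ 2) :* (x :* x) :* m := con (+ 2) :* ((:- x) :* (:- x)) :* m) (λ _ → refl) X (negateX M) ⟩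
    const (+ 2) ⊠ (⊟ X ⊠ ⊟ X) ⊠ negateX M
      ≈⟨ SeriesRing.*-congʳ {negateX M} (SeriesRing.*-cong (negateX-const (+ 2)) (SeriesRing.*-cong negateX-X negateX-X)) ⟨
    negateX (const (+ 2)) ⊠ (negateX X ⊠ negateX X) ⊠ negateX M
      ≈⟨ SeriesRing.trans (negateX-⊠ _ M) (SeriesRing.*-congʳ {negateX M}
           (SeriesRing.trans (negateX-⊠ _ X²) (SeriesRing.*-congˡ {negateX (const (+ 2))} (negateX-⊠ X X)))) ⟨
    negateX (const (+ 2) ⊠ X² ⊠ M)
      ≈⟨ negateX-cong 2X²M ⟩
    negateX (1ₛ ⊞ ⊟ X ⊞ ⊟ Q)
      ≈⟨ SeriesRing.trans (Univariate.negateX-⊞ _ _) (SeriesRing.+-cong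
           (SeriesRing.trans (Univariate.negateX-⊞ _ _) (SeriesRing.+-cong (negateX-const 1ℤ)
             (SeriesRing.trans (Univariate.negateX-⊟ X) (SeriesRing.-‿cong negateX-X))))
           (SeriesRing.trans (Univariate.negateX-⊟ Q) (SeriesRing.-‿cong (SeriesRing.sym R≋)))) ⟩
    1ₛ ⊞ ⊟ (⊟ X) ⊞ ⊟ R
      ≈⟨ SeriesRing.+-congʳ {⊟ R} (SeriesRing.+-congˡ {1ₛ} (λ k → ℤP.neg-involutive (X k))) ⟩
    1ₛ ⊞ X ⊞ ⊟ R ∎

  Q²-coeffs R²-coeffs : List ℤ
  Q²-coeffs = 1ℤ ∷ - (+ 2) ∷ - (+ 3) ∷ []
  R²-coeffs = 1ℤ ∷ + 2 ∷ - (+ 3) ∷ []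

  Q² : Q ⊠ Q ≋ horner Q²-coeffs
  Q² = begin
    Q ⊠ Q      ≈⟨ SeriesRing.*-cong Q≋Qz Q≋Qz ⟩
    Qz ⊠ Qz    ≈⟨ Qz-square ⟩
    poly Q²-coeffs    ≈⟨ poly≋horner Q²-coeffs ⟩
    horner Q²-coeffs  ∎

  R² : R ⊠ R ≋ horner R²-coeffs
  R² = begin
    R ⊠ R                               ≈⟨ SeriesRing.*-cong R≋ R≋ ⟩
    negateX Q ⊠ negateX Q               ≈⟨ negateX-⊠ Q Q ⟨
    negateX (Q ⊠ Q)                     ≈⟨ negateX-cong (SeriesRing.trans Q² (SeriesRing.sym (poly≋horner Q²-coeffs))) ⟩
    negateX (poly Q²-coeffs)            ≈⟨ negateX-quadratic _ _ _ ⟩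
    poly R²-coeffs                      ≈⟨ poly≋horner R²-coeffs ⟩
    horner R²-coeffs                    ∎

  QR : Series
  QR = Q ⊠ R

  substSq₁-P : substSq₁ P ≋ QR
  substSq₁-P = square-root-unique (substSq₁ P) QR
    (≡.trans P₀≡1 (≡.sym (≡.cong₂ ℤ._*_ (Q≋Qz 0) (≡.trans (R≋ 0) (Q≋Qz 0))))) (1≢0 P₀≡1) (begin
      substSq₁ P ⊠ substSq₁ P           ≈⟨ substSq₁-⊠ P P ⟨
      substSq₁ (P ⊠ P)                  ≈⟨ substSq₁-cong (λ k → ≡.trans (≡.sym (⊛≗⊠ P P k)) (PP≈ k)) ⟩
      substSq₁ (poly (1ℤ ∷ - (+ 10) ∷ + 9 ∷ []))  ≈⟨ substSq₁-poly (1ℤ ∷ - (+ 10) ∷ + 9 ∷ []) ⟩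
      hornerSq (1ℤ ∷ - (+ 10) ∷ + 9 ∷ [])
        ≈⟨ solve 1 (λ x → con 1ℤ :+ x :* x :* (con (- (+ 10)) :+ x :* x :* (con (+ 9) :+ x :* x :* con 0ℤ))
                       := (con 1ℤ :+ x :* (con (- (+ 2)) :+ x :* (con (- (+ 3)) :+ x :* con 0ℤ)))
                       :* (con 1ℤ :+ x :* (con (+ 2) :+ x :* (con (- (+ 3)) :+ x :* con 0ℤ)))) (λ _ → refl) X ⟩
      horner Q²-coeffs ⊠ horner R²-coeffs  ≈⟨ SeriesRing.*-cong Q² R² ⟨
      (Q ⊠ Q) ⊠ (R ⊠ R)                 ≈⟨ solve 2 (λ q r → (q :* q) :* (r :* r) := (q :* r) :* (q :* r)) (λ _ → refl) Q R ⟩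
      QR ⊠ QR                           ∎)

  substSq₁-2X⊛ : ∀ f → substSq₁ (poly (0ℤ ∷ + 2 ∷ []) ⊛ f) ≋ const (+ 2) ⊠ X² ⊠ substSq₁ f
  substSq₁-2X⊛ f = begin
    substSq₁ (poly (0ℤ ∷ + 2 ∷ []) ⊛ f)   ≈⟨ substSq₁-cong (λ k → ≡.trans (⊛≗⊠ (poly (0ℤ ∷ + 2 ∷ [])) f k) (SeriesRing.*-congʳ {f} poly-2X k)) ⟩
    substSq₁ (const (+ 2) ⊠ X ⊠ f)         ≈⟨ substSq₁-⊠ (const (+ 2) ⊠ X) f ⟩
    substSq₁ (const (+ 2) ⊠ X) ⊠ substSq₁ f
      ≈⟨ SeriesRing.*-congʳ {substSq₁ f} (SeriesRing.trans (substSq₁-⊠ (const (+ 2)) X)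
           (SeriesRing.*-cong (substSq₁-const (+ 2)) substSq₁-X)) ⟩
    const (+ 2) ⊠ X² ⊠ substSq₁ f          ∎

  substSq₁-2W² : ∀ W → poly (+ 2 ∷ []) ⊛ W ⊛ W ≈₁ poly (1ℤ ∷ - (+ 3) ∷ []) ⊕ P →
                 const (+ 2) ⊠ (substSq₁ W ⊠ substSq₁ W) ≋ hornerSq (1ℤ ∷ - (+ 3) ∷ []) ⊞ QR
  substSq₁-2W² W 2WW≈ = begin
    const (+ 2) ⊠ (substSq₁ W ⊠ substSq₁ W)
      ≈⟨ solve 2 (λ c w → c :* (w :* w) := c :* w :* w) (λ _ → refl) (const (+ 2)) (substSq₁ W) ⟩
    const (+ 2) ⊠ substSq₁ W ⊠ substSq₁ W
      ≈⟨ SeriesRing.trans (substSq₁-⊠ _ W) (SeriesRing.*-congʳ {substSq₁ W}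
           (SeriesRing.trans (substSq₁-⊠ (const (+ 2)) W) (SeriesRing.*-congʳ {substSq₁ W} (substSq₁-const (+ 2))))) ⟨
    substSq₁ (const (+ 2) ⊠ W ⊠ W)
      ≈⟨ substSq₁-cong (λ k → ≡.trans (SeriesRing.*-congʳ {W} (SeriesRing.*-congʳ {W} (SeriesRing.sym (poly-constant (+ 2)))) k)
           (≡.trans (SeriesRing.*-congʳ {W} (SeriesRing.sym (⊛≗⊠ (poly (+ 2 ∷ [])) W)) k)
             (≡.trans (≡.sym (⊛≗⊠ (poly (+ 2 ∷ []) ⊛ W) W k)) (2WW≈ k)))) ⟩
    substSq₁ (poly (1ℤ ∷ - (+ 3) ∷ []) ⊞ P)
      ≈⟨ SeriesRing.trans (substSq₁-⊞ _ P) (SeriesRing.+-cong (substSq₁-poly (1ℤ ∷ - (+ 3) ∷ [])) substSq₁-P) ⟩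
    hornerSq (1ℤ ∷ - (+ 3) ∷ []) ⊞ QR ∎

  module _ (aQR : ℕ → ℕ → ℕ) (size : ∀ n m → HasSize (IsAQRPath n m) (aQR n m)) where

    Ev Vw : Series
    Ev = substSq₁ (diag0 aQR)
    Vw = 1ₛ ⊞ ⊟ (const (+ 2) ⊠ X² ⊠ Ev)

    Vw-double : Vw ⊞ Vw ≋ Q ⊞ R
    Vw-double = begin
      Vw ⊞ Vw
        ≈⟨ solve 2 (λ x e → (con 1ℤ :- con (+ 2) :* (x :* x) :* e) :+ (con 1ℤ :- con (+ 2) :* (x :* x) :* e)
                          := con (+ 2) :- con (+ 2) :* (x :* x) :* (e :+ e)) (λ _ → refl) X Ev ⟩
      const (+ 2) ⊞ ⊟ (const (+ 2) ⊠ X² ⊠ (Ev ⊞ Ev))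
        ≈⟨ SeriesRing.+-congˡ {const (+ 2)} (SeriesRing.-‿cong (SeriesRing.*-congˡ {const (+ 2) ⊠ X²} (even-part-column₀ aQR size))) ⟩
      const (+ 2) ⊞ ⊟ (const (+ 2) ⊠ X² ⊠ (M ⊞ negateX M))
        ≈⟨ SeriesRing.+-congˡ {const (+ 2)} (SeriesRing.-‿cong (SeriesRing.trans (SeriesRing.distribˡ (const (+ 2) ⊠ X²) M (negateX M))
             (SeriesRing.+-cong 2X²M 2X²M⁻))) ⟩
      const (+ 2) ⊞ ⊟ ((1ₛ ⊞ ⊟ X ⊞ ⊟ Q) ⊞ (1ₛ ⊞ X ⊞ ⊟ R))
        ≈⟨ solve 3 (λ x q r → con (+ 2) :- ((con 1ℤ :- x :- q) :+ (con 1ℤ :+ x :- r)) := q :+ r) (λ _ → refl) X Q R ⟩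
      Q ⊞ R ∎

    2Vw² : const (+ 2) ⊠ (Vw ⊠ Vw) ≋ hornerSq (1ℤ ∷ - (+ 3) ∷ []) ⊞ QR
    2Vw² = ⊠-cancelˡ (const (+ 4)) _ _ (λ ()) (begin
      const (+ 4) ⊠ (const (+ 2) ⊠ (Vw ⊠ Vw))
        ≈⟨ solve 1 (λ v → con (+ 4) :* (con (+ 2) :* (v :* v)) := con (+ 2) :* ((v :+ v) :* (v :+ v))) (λ _ → refl) Vw ⟩
      const (+ 2) ⊠ ((Vw ⊞ Vw) ⊠ (Vw ⊞ Vw))
        ≈⟨ SeriesRing.*-congˡ {const (+ 2)} (SeriesRing.*-cong Vw-double Vw-double) ⟩
      const (+ 2) ⊠ ((Q ⊞ R) ⊠ (Q ⊞ R))
        ≈⟨ solve 2 (λ q r → con (+ 2) :* ((q :+ r) :* (q :+ r)) := con (+ 2) :* (q :* q :+ r :* r) :+ con (+ 4) :* (q :* r))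
                   (λ _ → refl) Q R ⟩
      const (+ 2) ⊠ (Q ⊠ Q ⊞ R ⊠ R) ⊞ const (+ 4) ⊠ QR
        ≈⟨ SeriesRing.+-congʳ {const (+ 4) ⊠ QR} (SeriesRing.*-congˡ {const (+ 2)} (SeriesRing.+-cong Q² R²)) ⟩
      const (+ 2) ⊠ (horner Q²-coeffs ⊞ horner R²-coeffs) ⊞ const (+ 4) ⊠ QR
        ≈⟨ solve 2 (λ x qr → con (+ 2) :* ((con 1ℤ :+ x :* (con (- (+ 2)) :+ x :* (con (- (+ 3)) :+ x :* con 0ℤ)))
                                           :+ (con 1ℤ :+ x :* (con (+ 2) :+ x :* (con (- (+ 3)) :+ x :* con 0ℤ))))
                             :+ con (+ 4) :* qr
                           := con (+ 4) :* ((con 1ℤ :+ x :* x :* (con (- (+ 3)) :+ x :* x :* con 0ℤ)) :+ qr))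
                   (λ _ → refl) X QR ⟩
      const (+ 4) ⊠ (hornerSq (1ℤ ∷ - (+ 3) ∷ []) ⊞ QR) ∎)

    identity₃ : ∀ W → W 0 ≡ 1ℤ → poly (+ 2 ∷ []) ⊛ W ⊛ W ≈₁ poly (1ℤ ∷ - (+ 3) ∷ []) ⊕ P →
                poly (0ℤ ∷ + 2 ∷ []) ⊛ diag0 aQR ≈₁ poly (1ℤ ∷ []) ⊖ W
    identity₃ W W₀≡1 2WW≈ = substSq₁-injective _ _ (begin
      substSq₁ (poly (0ℤ ∷ + 2 ∷ []) ⊛ diag0 aQR)     ≈⟨ substSq₁-2X⊛ (diag0 aQR) ⟩
      const (+ 2) ⊠ X² ⊠ Ev                           ≈⟨ solve 2 (λ x e → con (+ 2) :* (x :* x) :* e := con 1ℤ :- (con 1ℤ :- con (+ 2) :* (x :* x) :* e))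
                                                                 (λ _ → refl) X Ev ⟩
      1ₛ ⊞ ⊟ Vw                                       ≈⟨ SeriesRing.+-congˡ {1ₛ} (SeriesRing.-‿cong substSq₁-W≋Vw) ⟨
      1ₛ ⊞ ⊟ substSq₁ W
        ≈⟨ SeriesRing.trans (substSq₁-⊞ (poly (1ℤ ∷ [])) (⊟ W)) (SeriesRing.+-cong
             (SeriesRing.trans (substSq₁-cong (poly-constant 1ℤ)) (substSq₁-const 1ℤ)) (substSq₁-⊟ W)) ⟨
      substSq₁ (poly (1ℤ ∷ []) ⊖ W)                   ∎)
      where
      substSq₁-W≋Vw : substSq₁ W ≋ Vw
      substSq₁-W≋Vw = square-root-unique (substSq₁ W) Vw W₀≡1 (1≢0 W₀≡1)
        (⊠-cancelˡ (const (+ 2)) _ _ (λ ()) (SeriesRing.trans (substSq₁-2W² W 2WW≈) (SeriesRing.sym 2Vw²)))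

  2X²-cancel : ∀ f g → const (+ 2) ⊠ X² ⊠ f ≋ const (+ 2) ⊠ X² ⊠ g → f ≋ g
  2X²-cancel f g eq = ⊠-cancelˡ (const (+ 2)) f g (λ ()) (X-⊠-cancel _ _ (X-⊠-cancel _ _ (begin
    X ⊠ (X ⊠ (const (+ 2) ⊠ f))   ≈⟨ rearrange f ⟩
    const (+ 2) ⊠ X² ⊠ f          ≈⟨ eq ⟩
    const (+ 2) ⊠ X² ⊠ g          ≈⟨ rearrange g ⟨
    X ⊠ (X ⊠ (const (+ 2) ⊠ g))   ∎)))
    where
    rearrange : ∀ h → X ⊠ (X ⊠ (const (+ 2) ⊠ h)) ≋ const (+ 2) ⊠ X² ⊠ h
    rearrange h = solve 2 (λ x h → x :* (x :* (con (+ 2) :* h)) := con (+ 2) :* (x :* x) :* h) (λ _ → refl) X h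

  module _ (aQ : ℕ → ℕ → ℕ) (size : ∀ n m → HasSize (IsAQPath n m) (aQ n m)) where

    Od Vc : Series
    Od = substSq₁ (diag0 aQ)
    Vc = 1ₛ ⊞ const (+ 2) ⊠ X² ⊠ Od

    XVc-double : X ⊠ Vc ⊞ X ⊠ Vc ≋ R ⊞ ⊟ Q
    XVc-double = begin
      X ⊠ Vc ⊞ X ⊠ Vc
        ≈⟨ solve 2 (λ x o → x :* (con 1ℤ :+ con (+ 2) :* (x :* x) :* o) :+ x :* (con 1ℤ :+ con (+ 2) :* (x :* x) :* o)
                          := x :+ x :+ con (+ 2) :* (x :* x) :* (x :* o :+ x :* o)) (λ _ → refl) X Od ⟩
      X ⊞ X ⊞ const (+ 2) ⊠ X² ⊠ (X ⊠ Od ⊞ X ⊠ Od)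
        ≈⟨ SeriesRing.+-congˡ {X ⊞ X} (SeriesRing.*-congˡ {const (+ 2) ⊠ X²} (odd-part-column₀ aQ size)) ⟩
      X ⊞ X ⊞ const (+ 2) ⊠ X² ⊠ (M ⊞ ⊟ negateX M)
        ≈⟨ SeriesRing.+-congˡ {X ⊞ X} (SeriesRing.trans
             (solve 3 (λ c m n → c :* (m :- n) := c :* m :- c :* n) (λ _ → refl) (const (+ 2) ⊠ X²) M (negateX M))
             (SeriesRing.+-cong 2X²M (SeriesRing.-‿cong 2X²M⁻))) ⟩
      X ⊞ X ⊞ ((1ₛ ⊞ ⊟ X ⊞ ⊟ Q) ⊞ ⊟ (1ₛ ⊞ X ⊞ ⊟ R))
        ≈⟨ solve 3 (λ x q r → x :+ x :+ ((con 1ℤ :- x :- q) :- (con 1ℤ :+ x :- r)) := r :- q) (λ _ → refl) X Q R ⟩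
      R ⊞ ⊟ Q ∎

    2X²Vc² : const (+ 2) ⊠ X² ⊠ (Vc ⊠ Vc) ≋ hornerSq (1ℤ ∷ - (+ 3) ∷ []) ⊞ ⊟ QR
    2X²Vc² = ⊠-cancelˡ (const (+ 4)) _ _ (λ ()) (begin
      const (+ 4) ⊠ (const (+ 2) ⊠ X² ⊠ (Vc ⊠ Vc))
        ≈⟨ solve 2 (λ x v → con (+ 4) :* (con (+ 2) :* (x :* x) :* (v :* v)) := con (+ 2) :* ((x :* v :+ x :* v) :* (x :* v :+ x :* v)))
                   (λ _ → refl) X Vc ⟩
      const (+ 2) ⊠ ((X ⊠ Vc ⊞ X ⊠ Vc) ⊠ (X ⊠ Vc ⊞ X ⊠ Vc))
        ≈⟨ SeriesRing.*-congˡ {const (+ 2)} (SeriesRing.*-cong XVc-double XVc-double) ⟩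
      const (+ 2) ⊠ ((R ⊞ ⊟ Q) ⊠ (R ⊞ ⊟ Q))
        ≈⟨ solve 2 (λ q r → con (+ 2) :* ((r :- q) :* (r :- q)) := con (+ 2) :* (q :* q :+ r :* r) :- con (+ 4) :* (q :* r))
                   (λ _ → refl) Q R ⟩
      const (+ 2) ⊠ (Q ⊠ Q ⊞ R ⊠ R) ⊞ ⊟ (const (+ 4) ⊠ QR)
        ≈⟨ SeriesRing.+-congʳ {⊟ (const (+ 4) ⊠ QR)} (SeriesRing.*-congˡ {const (+ 2)} (SeriesRing.+-cong Q² R²)) ⟩
      const (+ 2) ⊠ (horner Q²-coeffs ⊞ horner R²-coeffs) ⊞ ⊟ (const (+ 4) ⊠ QR)
        ≈⟨ solve 2 (λ x qr → con (+ 2) :* ((con 1ℤ :+ x :* (con (- (+ 2)) :+ x :* (con (- (+ 3)) :+ x :* con 0ℤ)))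
                                           :+ (con 1ℤ :+ x :* (con (+ 2) :+ x :* (con (- (+ 3)) :+ x :* con 0ℤ))))
                             :- con (+ 4) :* qr
                           := con (+ 4) :* ((con 1ℤ :+ x :* x :* (con (- (+ 3)) :+ x :* x :* con 0ℤ)) :- qr))
                   (λ _ → refl) X QR ⟩
      const (+ 4) ⊠ (hornerSq (1ℤ ∷ - (+ 3) ∷ []) ⊞ ⊟ QR) ∎)

    identity₄ : ∀ V → V 0 ≡ 1ℤ → poly (0ℤ ∷ + 2 ∷ []) ⊛ V ⊛ V ≈₁ poly (1ℤ ∷ - (+ 3) ∷ []) ⊖ P →
                poly (0ℤ ∷ + 2 ∷ []) ⊛ diag0 aQ ≈₁ V ⊖ poly (1ℤ ∷ [])
    identity₄ V V₀≡1 2XVV≈ = substSq₁-injective _ _ (begin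
      substSq₁ (poly (0ℤ ∷ + 2 ∷ []) ⊛ diag0 aQ)      ≈⟨ substSq₁-2X⊛ (diag0 aQ) ⟩
      const (+ 2) ⊠ X² ⊠ Od                           ≈⟨ solve 2 (λ x o → con (+ 2) :* (x :* x) :* o := (con 1ℤ :+ con (+ 2) :* (x :* x) :* o) :- con 1ℤ)
                                                                 (λ _ → refl) X Od ⟩
      Vc ⊞ ⊟ 1ₛ                                       ≈⟨ SeriesRing.+-congʳ {⊟ 1ₛ} substSq₁-V≋Vc ⟨
      substSq₁ V ⊞ ⊟ 1ₛ
        ≈⟨ SeriesRing.trans (substSq₁-⊞ V (⊟ poly (1ℤ ∷ []))) (SeriesRing.+-congˡ {substSq₁ V}
             (SeriesRing.trans (substSq₁-⊟ (poly (1ℤ ∷ []))) (SeriesRing.-‿cong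
               (SeriesRing.trans (substSq₁-cong (poly-constant 1ℤ)) (substSq₁-const 1ℤ))))) ⟨
      substSq₁ (V ⊖ poly (1ℤ ∷ []))                   ∎)
      where
      2X²sqV² : const (+ 2) ⊠ X² ⊠ (substSq₁ V ⊠ substSq₁ V) ≋ hornerSq (1ℤ ∷ - (+ 3) ∷ []) ⊞ ⊟ QR
      2X²sqV² = begin
        const (+ 2) ⊠ X² ⊠ (substSq₁ V ⊠ substSq₁ V)
          ≈⟨ SeriesRing.*-assoc (const (+ 2) ⊠ X²) (substSq₁ V) (substSq₁ V) ⟨
        const (+ 2) ⊠ X² ⊠ substSq₁ V ⊠ substSq₁ V
          ≈⟨ SeriesRing.trans (substSq₁-⊠ (poly (0ℤ ∷ + 2 ∷ []) ⊛ V) V)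
               (SeriesRing.*-congʳ {substSq₁ V} (substSq₁-2X⊛ V)) ⟨
        substSq₁ ((poly (0ℤ ∷ + 2 ∷ []) ⊛ V) ⊠ V)
          ≈⟨ substSq₁-cong (λ k → ≡.trans (≡.sym (⊛≗⊠ (poly (0ℤ ∷ + 2 ∷ []) ⊛ V) V k)) (2XVV≈ k)) ⟩
        substSq₁ (poly (1ℤ ∷ - (+ 3) ∷ []) ⊞ ⊟ P)
          ≈⟨ SeriesRing.trans (substSq₁-⊞ _ (⊟ P)) (SeriesRing.+-cong (substSq₁-poly (1ℤ ∷ - (+ 3) ∷ []))
               (SeriesRing.trans (substSq₁-⊟ P) (SeriesRing.-‿cong substSq₁-P))) ⟩
        hornerSq (1ℤ ∷ - (+ 3) ∷ []) ⊞ ⊟ QR ∎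

      substSq₁-V≋Vc : substSq₁ V ≋ Vc
      substSq₁-V≋Vc = square-root-unique (substSq₁ V) Vc V₀≡1 (1≢0 V₀≡1)
        (2X²-cancel _ _ (SeriesRing.trans 2X²sqV² (SeriesRing.sym 2X²Vc²)))

corollary10 :
  (aQ aQR : ℕ → ℕ → ℕ) →
  (∀ n m → HasSize (IsAQPath n m) (aQ n m)) →
  (∀ n m → HasSize (IsAQRPath n m) (aQR n m)) →
  -- Q = √(1 - 2t - 3t²), R = √(1 + 2t - 3t²) as series in t = √x
  (Q R : Series1) →
  Q 0 ≡ 1ℤ → Q ⊛ Q ≈₁ poly (1ℤ ∷ - (+ 2) ∷ - (+ 3) ∷ []) →
  R 0 ≡ 1ℤ → R ⊛ R ≈₁ poly (1ℤ ∷ + 2 ∷ - (+ 3) ∷ []) →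
  -- P = √(1 - 10x + 9x²), as a series in x
  (P : Series1) →
  P 0 ≡ 1ℤ → P ⊛ P ≈₁ poly (1ℤ ∷ - (+ 10) ∷ + 9 ∷ []) →
  -- W = √((1 - 3x + P)/2), i.e. 2 W² = 1 - 3x + P
  (W : Series1) →
  W 0 ≡ 1ℤ → poly (+ 2 ∷ []) ⊛ W ⊛ W ≈₁ poly (1ℤ ∷ - (+ 3) ∷ []) ⊕ P →
  -- V = √((1 - 3x - P)/(2x)), i.e. 2x V² = 1 - 3x - P
  (V : Series1) →
  V 0 ≡ 1ℤ → poly (0ℤ ∷ + 2 ∷ []) ⊛ V ⊛ V ≈₁ poly (1ℤ ∷ - (+ 3) ∷ []) ⊖ P →
  -- first identity (multiplied out by the denominator)
  (substSq aQR ⊛₂ (lift (poly (1ℤ ∷ []) ⊕ Q) ⊖₂ tY)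
               ⊛₂ (lift (poly (1ℤ ∷ []) ⊕ R) ⊕₂ tY)
     ≈₂ lift (R ⊕ Q ⊕ poly (+ 2 ∷ [])))
  ×
  -- second identity (multiplied out by the denominator)
  (tS ⊛₂ substSq aQ ⊛₂ (lift (poly (1ℤ ∷ []) ⊕ Q) ⊖₂ tY)
                    ⊛₂ (lift (poly (1ℤ ∷ []) ⊕ R) ⊕₂ tY)
     ≈₂ lift (R ⊖ Q) ⊕₂ tY ⊕₂ tY)
  ×
  -- third identity: 2x · Σ A^Q_R(n,0) xⁿ = 1 - W
  (poly (0ℤ ∷ + 2 ∷ []) ⊛ diag0 aQR ≈₁ poly (1ℤ ∷ []) ⊖ W)
  ×
  -- fourth identity: 2x · Σ A^Q(n,0) xⁿ = V - 1
  (poly (0ℤ ∷ + 2 ∷ []) ⊛ diag0 aQ ≈₁ V ⊖ poly (1ℤ ∷ []))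
corollary10 aQ aQR aQ-size aQR-size Q R Q₀≡1 QQ≈ R₀≡1 RR≈ P P₀≡1 PP≈ W W₀≡1 2WW≈ V V₀≡1 2XVV≈ =
  identity₁ aQR aQR-size , identity₂ aQ aQ-size , identity₃ aQR aQR-size W W₀≡1 2WW≈ , identity₄ aQ aQ-size V V₀≡1 2XVV≈
  where
  Q-explicit : Q ≋ Qz
  Q-explicit = Q≋Qz Q Q₀≡1 QQ≈
  R-reflected : R ≋ negateX Q
  R-reflected = R≋negateX-Q Q R Q₀≡1 QQ≈ R₀≡1 RR≈
  open Identities12 Q R Q-explicit R-reflected
  open Identities34 Q R P Q-explicit R-reflected P₀≡1 PP≈
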